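{- Let $i,j\ge 0$ be integers. For $(i,j)\neq(0,0)$, the length generating function $\mathcal O_{i,j}(t;1,1)$ of osculating $(i,j)$-stars is algebraic and belongs to $\mathbb{Q}(t,\sqrt{1-8t})$. For instance, $$\mathcal O_{1,1}(t;1,1)=\frac{3-15t-4t^2-3(1-t)\sqrt{1-8t}}{8t^2(1+t)}.$$ More generally, let $T\equiv T(t)$ be the unique formal power series in $t$ satisfying $T=2t(1+T)^2$, namely $T=\frac{1-4t-\sqrt{1-8t}}{4t}$. Then, for $(i,j)\neq(0,0)$, $$(1-8t)\,\mathcal O_{i,j}(t;1,1)=1-3\frac{T^{j+1}}{1+2T}+3\frac{T^{i+j+1}}{2+T}-3\frac{T^{i+1}}{1+2T}=1-3\frac{t}{1+t}\left(T^j(2+T)-T^{i+j}(1+2T)+T^i(2+T)\right).$$ Moreover, for all $i,j\ge 0$, the length generating function $\mathcal V_{i,j}(t;1,1)$ of vicious $(i,j)$-stars is algebraic, belongs to $\mathbb{Q}(t,\sqrt{1-8t})$, and $$(1-8t)\,\mathcal V_{i,j}(t;1,1)=(1-T^i)(1-T^j).$$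
   Context: Consider three directed walkers on the square lattice. At time $0$ they are at abscissa $0$ and ordinates $j_{0,1}\le j_{0,2}\le j_{0,3}$; at each time $m=1,\dots,n$ each walker takes a step $(1,1)$ or $(1,-1)$. Let $j_{m,k}$ denote the ordinate of walker $k$ at time $m$; the resulting set of trajectories is a configuration of length $n$. It is non-crossing if $j_{m,1}\le j_{m,2}\le j_{m,3}$ for all $m\in\{0,\dots,n\}$. It is vicious (non-intersecting) if $j_{m,1}<j_{m,2}<j_{m,3}$ for all $m\in\{0,\dots,n\}$. It is osculating if it is non-crossing and whenever $j_{m,k}=j_{m,k+1}$ for some $m\in\{0,\dots,n-1\}$ and $k\in\{1,2\}$, then $j_{m+1,k}<j_{m+1,k+1}$ (walkers may meet but never share an edge nor cross). For integers $i,j\ge0$, an $(i,j)$-star is a non-crossing configuration whose walkers start at ordinates $0,2i,2(i+j)$. The complete generating function of osculating $(i,j)$-stars is $\mathcal O_{i,j}(t;x,y)=\sum_{k,\ell,n\ge0} o_{i,j}^{(k,\ell)}(n)x^ky^\ell t^n$, where $o_{i,j}^{(k,\ell)}(n)$ is the number of osculating $(i,j)$-stars of length $n$ whose final ordinates $j_1,j_2,j_3$ (at time $n$) satisfy $j_2-j_1=2k$, $j_3-j_2=2\ell$; $\mathcal V_{i,j}(t;x,y)$ is defined in the same way for vicious $(i,j)$-stars. The length generating functions are the specializations at $x=y=1$. -}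

module Defs where

open import Data.Bool using (Bool; true; false; _∧_; _∨_; not)
open import Data.Nat as ℕ using (ℕ; zero; suc; _∸_)
open import Data.Integer as ℤ using (ℤ; +_)
open import Data.Rational as ℚ using (ℚ; 0ℚ; 1ℚ)
open import Data.List using (List; []; _∷_; map; concatMap; filter; length; foldr; upTo)
open import Data.Product using (_×_; _,_; ∃; Σ)
open import Data.List.Relation.Unary.Any using (Any)
open import Relation.Nullary using (¬_)
open import Relation.Binary.PropositionalEquality using (_≡_)
open import Relation.Nullary.Decidable using (Dec)
open import Data.Bool using (T)

-- a step of one walker: true = (1,1), false = (1,-1)
-- a step of the configuration: steps of walkers 1,2,3
Step3 : Set
Step3 = Bool × Bool × Bool

-- ordinates (j_{m,1}, j_{m,2}, j_{m,3}) at some time m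
Pos : Set
Pos = ℤ × ℤ × ℤ

move : ℤ → Bool → ℤ
move y true  = y ℤ.+ ℤ.1ℤ
move y false = y ℤ.- ℤ.1ℤ

step : Pos → Step3 → Pos
step (a , b , c) (s , u , v) = move a s , move b u , move c v

_≤b_ : ℤ → ℤ → Bool
a ≤b b = a ℤ.≤ᵇ b

_<b_ : ℤ → ℤ → Bool
a <b b = (a ℤ.+ ℤ.1ℤ) ℤ.≤ᵇ b

_==b_ : ℤ → ℤ → Bool
a ==b b = (a ℤ.≤ᵇ b) ∧ (b ℤ.≤ᵇ a)

nonCrossingAt : Pos → Bool
nonCrossingAt (a , b , c) = (a ≤b b) ∧ (b ≤b c)

strictAt : Pos → Bool
strictAt (a , b , c) = (a <b b) ∧ (b <b c)

meetOK : Pos → Pos → Bool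
meetOK (a , b , c) (a' , b' , c') =
  (not (a ==b b) ∨ (a' <b b')) ∧ (not (b ==b c) ∨ (b' <b c'))

osculating : Pos → List Step3 → Bool
osculating p []       = nonCrossingAt p
osculating p (s ∷ ss) = nonCrossingAt p ∧ meetOK p (step p s) ∧ osculating (step p s) ss

vicious : Pos → List Step3 → Bool
vicious p []       = strictAt p
vicious p (s ∷ ss) = strictAt p ∧ vicious (step p s) ss

allStep3 : List Step3
allStep3 = concatMap (λ a → concatMap (λ b → map (λ c → a , b , c) (true ∷ false ∷ [])) (true ∷ false ∷ [])) (true ∷ false ∷ [])

allSeqs : ℕ → List (List Step3)
allSeqs zero    = [] ∷ []
allSeqs (suc n) = concatMap (λ s → map (s ∷_) (allSeqs n)) allStep3

-- starting point of an (i,j)-star: ordinates 0, 2i, 2(i+j)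
star : ℕ → ℕ → Pos
star i j = + 0 , + (2 ℕ.* i) , + (2 ℕ.* (i ℕ.+ j))

countBy : (List Step3 → Bool) → ℕ → ℕ
countBy P n = length (filter (λ w → T? (P w)) (allSeqs n))
  where
  open import Relation.Nullary.Decidable using (yes; no)
  T? : (b : Bool) → Dec (T b)
  T? true  = yes _
  T? false = no (λ ())

-- number of osculating / vicious (i,j)-stars of length n (all endpoints)
oscCount : ℕ → ℕ → ℕ → ℕ
oscCount i j = countBy (osculating (star i j))

vicCount : ℕ → ℕ → ℕ → ℕ
vicCount i j = countBy (vicious (star i j))

PS : Set
PS = ℕ → ℚ

infix 4 _≈_
_≈_ : PS → PS → Set
F ≈ G = ∀ n → F n ≡ G n

ℚ[_] : ℕ → ℚ
ℚ[ n ] = (+ n) ℚ./ 1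

κ : ℚ → PS
κ a zero    = a
κ a (suc n) = 0ℚ

tt : PS
tt zero          = 0ℚ
tt (suc zero)    = 1ℚ
tt (suc (suc n)) = 0ℚ

infixl 6 _⊕_ _⊖_
infixl 7 _⊛_ _·_

_⊕_ : PS → PS → PS
(F ⊕ G) n = F n ℚ.+ G n

_⊖_ : PS → PS → PS
(F ⊖ G) n = F n ℚ.- G n

_·_ : ℚ → PS → PS
(a · F) n = a ℚ.* F n

_⊛_ : PS → PS → PS
(F ⊛ G) n = foldr ℚ._+_ 0ℚ (map (λ k → F k ℚ.* G (n ∸ k)) (upTo (suc n)))

infixr 8 _^^_
_^^_ : PS → ℕ → PS
F ^^ zero  = κ 1ℚ
F ^^ suc n = F ⊛ (F ^^ n)

c : ℕ → PS
c n = κ ℚ[ n ]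

O : ℕ → ℕ → PS
O i j n = ℚ[ oscCount i j n ]

V : ℕ → ℕ → PS
V i j n = ℚ[ vicCount i j n ]

Poly : Set
Poly = List ℚ   -- coefficients, constant term first

poly : Poly → PS
poly []       = κ 0ℚ
poly (a ∷ as) = κ a ⊕ tt ⊛ poly as

InQtS : PS → PS → Set
InQtS S F = Σ Poly λ P → Σ Poly λ Q → Σ Poly λ R →
  (¬ (poly R ≈ κ 0ℚ)) × (poly R ⊛ F ≈ poly P ⊕ poly Q ⊛ S)

evalAt : List Poly → PS → PS
evalAt []       F = κ 0ℚ
evalAt (A ∷ As) F = poly A ⊕ F ⊛ evalAt As F

Algebraic : PS → Set
Algebraic F = Σ (List Poly) λ As →
  Any (λ A → ¬ (poly A ≈ κ 0ℚ)) As × (evalAt As F ≈ κ 0ℚ)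

module Submission where

-- Write the ordinates of a star as (x, x + 2i, x + 2i + 2j). Whether a step is allowed, and
-- the new half-gaps, depend only on (i, j) and the steps of neighbouring walkers, so the
-- number of stars of length n + 1 is a sum over the eight steps of numbers of stars of
-- length n; no step leads to half-gaps (0, 0). With X = Tⁱ and Y = Tʲ, the series
--   (1 + t − 3t (Y (2 + T) − X Y (1 + 2T) + X (2 + T))) / ((1 − 8t)(1 + t))  and
--   (1 − X)(1 − Y) / (1 − 8t)
-- satisfy the same recursions (each instance is a polynomial identity modulo
-- T = 2t(1 + T)²) and have the same constant terms, so they are the generating functions.
-- Finally S = 1 − 4t − 4tT is the square root of 1 − 8t with constant term 1, so T and
-- hence both generating functions lie in ℚ(t, S), whose elements are algebraic.

open import Defs
open import Algebra.Bundles using (CommutativeRing)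
import Algebra.Solver.Ring.AlmostCommutativeRing as ACR
import Algebra.Solver.Ring
open import Data.Bool using (Bool; true; false; not; _∧_; _∨_; if_then_else_; T)
open import Data.Bool.Properties using (∧-zeroʳ; T-≡)
open import Data.Empty using (⊥-elim)
open import Data.Integer as ℤ using (ℤ; +_; -[1+_])
import Data.Integer.Properties as ℤP
import Data.Integer.Solver
open import Data.List using (List; []; _∷_; foldr; map; concatMap; filter; length; _++_; applyUpTo)
open import Data.List.Properties using (map-applyUpTo)
open import Data.List.Relation.Unary.All using (All; []; _∷_)
open import Data.List.Relation.Unary.Any using (here; there)
open import Data.Maybe using (Maybe; just; nothing; maybe′; zip)
open import Data.Nat as ℕ using (ℕ; zero; suc; _+_; _*_; _≤_; z≤n; s≤s)
import Data.Nat.Properties as ℕP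
open import Data.Nat.Coprimality using (1-coprimeTo) renaming (sym to coprime-sym)
open import Data.Product using (_×_; _,_; uncurry)
open import Data.Rational as ℚ using (ℚ; 0ℚ; 1ℚ; mkℚ)
import Data.Rational.Properties as ℚP
import Data.Rational.Solver
open import Function using (id)
open import Function.Bundles using (Equivalence)
open import Relation.Binary.PropositionalEquality
open import Relation.Nullary using (¬_; Dec; yes; no)

open ≡-Reasoning

module ℤ-Solver = Data.Integer.Solver.+-*-Solver
module ℚ-Solver = Data.Rational.Solver.+-*-Solver

-- Counting stars by half-gaps

≤ᵇ-true : ∀ a b n → b ≡ a ℤ.+ + n → (a ℤ.≤ᵇ b) ≡ true
≤ᵇ-true a _ n refl = Equivalence.to T-≡ (ℤP.≤⇒≤ᵇ (ℤP.i≤i+j a (+ n)))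

≤ᵇ-false : ∀ a b n → a ≡ b ℤ.+ + suc n → (a ℤ.≤ᵇ b) ≡ false
≤ᵇ-false _ b n refl with (b ℤ.+ + suc n) ℤ.≤ᵇ b in eq
... | false = refl
... | true  = ⊥-elim (ℤP.<⇒≱ b<b+1+n (ℤP.≤ᵇ⇒≤ (Equivalence.from T-≡ eq)))
  where
  b<b+1+n : b ℤ.< b ℤ.+ + suc n
  b<b+1+n = subst (ℤ._< b ℤ.+ + suc n) (ℤP.+-identityʳ b) (ℤP.+-monoʳ-< b (ℤ.+<+ (ℕ.s≤s ℕ.z≤n)))

==b-+0 : ∀ x → (x ==b (x ℤ.+ + 0)) ≡ true
==b-+0 x = cong₂ _∧_ (≤ᵇ-true x (x ℤ.+ + 0) 0 refl)
                     (≤ᵇ-true (x ℤ.+ + 0) x 0 (sym (trans (cong (ℤ._+ + 0) (ℤP.+-identityʳ x)) (ℤP.+-identityʳ x))))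

==b-+suc : ∀ x n → (x ==b (x ℤ.+ + suc n)) ≡ false
==b-+suc x n = trans (cong ((x ℤ.≤ᵇ (x ℤ.+ + suc n)) ∧_) (≤ᵇ-false (x ℤ.+ + suc n) x n refl)) (∧-zeroʳ _)

-- meetOK p p′ is the conjunction of this condition for both pairs of neighbours.
separatesIfMet : ℤ → ℤ → ℤ → ℤ → Bool
separatesIfMet x y x′ y′ = not (x ==b y) ∨ (x′ <b y′)

-- How the half-gap between two neighbouring osculating walkers evolves under
-- their steps (a, b): nothing when the step is forbidden.
gapStep : ℕ → Bool → Bool → Maybe ℕ
gapStep zero    false true  = just 1
gapStep zero    _     _     = nothing
gapStep (suc k) true  true  = just (suc k)
gapStep (suc k) false false = just (suc k)
gapStep (suc k) false true  = just (suc (suc k))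
gapStep (suc k) true  false = just k

meeting : ∀ x y x′ y′ → (x ==b y) ≡ true → separatesIfMet x y x′ y′ ≡ (x′ <b y′)
meeting x y x′ y′ met = cong (λ m → not m ∨ (x′ <b y′)) met

apart : ∀ x y x′ y′ → (x ==b y) ≡ false → separatesIfMet x y x′ y′ ≡ true
apart x y x′ y′ ¬met = cong (λ m → not m ∨ (x′ <b y′)) ¬met

twice-suc : ∀ m → + (2 * suc m) ≡ + 2 ℤ.+ + (2 * m)
twice-suc m = cong +_ (ℕP.*-suc 2 m)

data GapStep (x y : ℤ) (a b : Bool) : Maybe ℕ → Set where
  separate : ∀ i′ → separatesIfMet x y (move x a) (move y b) ≡ true →
             move y b ≡ move x a ℤ.+ + (2 * i′) → GapStep x y a b (just i′)
  collide  : separatesIfMet x y (move x a) (move y b) ≡ false → GapStep x y a b nothing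

gapStep-spec : ∀ x i a b → GapStep x (x ℤ.+ + (2 * i)) a b (gapStep i a b)
gapStep-spec x zero a b = after-meeting a b
  where
  open ℤ-Solver
  y : ℤ
  y = x ℤ.+ + 0
  meet-separates : ∀ a b n → move y b ≡ (move x a ℤ.+ ℤ.1ℤ) ℤ.+ + n →
                   separatesIfMet x y (move x a) (move y b) ≡ true
  meet-separates a b n e = trans (meeting x y (move x a) (move y b) (==b-+0 x)) (≤ᵇ-true (move x a ℤ.+ ℤ.1ℤ) (move y b) n e)
  meet-collides : ∀ a b n → move x a ℤ.+ ℤ.1ℤ ≡ move y b ℤ.+ + suc n →
                  separatesIfMet x y (move x a) (move y b) ≡ false
  meet-collides a b n e = trans (meeting x y (move x a) (move y b) (==b-+0 x)) (≤ᵇ-false (move x a ℤ.+ ℤ.1ℤ) (move y b) n e)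
  after-meeting : ∀ a b → GapStep x y a b (gapStep 0 a b)
  after-meeting false true  = separate 1
    (meet-separates false true 1 (solve 1 (λ x → (x :+ con (+ 0)) :+ con (+ 1) := ((x :- con (+ 1)) :+ con (+ 1)) :+ con (+ 1)) refl x))
    (solve 1 (λ x → (x :+ con (+ 0)) :+ con (+ 1) := (x :- con (+ 1)) :+ con (+ 2)) refl x)
  after-meeting true  true  = collide
    (meet-collides true true 0 (solve 1 (λ x → (x :+ con (+ 1)) :+ con (+ 1) := ((x :+ con (+ 0)) :+ con (+ 1)) :+ con (+ 1)) refl x))
  after-meeting false false = collide
    (meet-collides false false 0 (solve 1 (λ x → (x :- con (+ 1)) :+ con (+ 1) := ((x :+ con (+ 0)) :- con (+ 1)) :+ con (+ 1)) refl x))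
  after-meeting true  false = collide
    (meet-collides true false 2 (solve 1 (λ x → (x :+ con (+ 1)) :+ con (+ 1) := ((x :+ con (+ 0)) :- con (+ 1)) :+ con (+ 3)) refl x))
gapStep-spec x (suc k) a b = apart-step a b
  where
  open ℤ-Solver
  y : ℤ
  y = x ℤ.+ + (2 * suc k)
  separated : ∀ a b → separatesIfMet x y (move x a) (move y b) ≡ true
  separated a b = apart x y (move x a) (move y b) (==b-+suc x (k + 1 * suc k))
  apart-step : ∀ a b → GapStep x y a b (gapStep (suc k) a b)
  apart-step true  true  = separate (suc k) (separated true true)
    (solve 2 (λ x g → (x :+ g) :+ con (+ 1) := (x :+ con (+ 1)) :+ g) refl x (+ (2 * suc k)))
  apart-step false false = separate (suc k) (separated false false)
    (solve 2 (λ x g → (x :+ g) :- con (+ 1) := (x :- con (+ 1)) :+ g) refl x (+ (2 * suc k)))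
  apart-step false true  = separate (suc (suc k)) (separated false true)
    (trans (solve 2 (λ x g → (x :+ g) :+ con (+ 1) := (x :- con (+ 1)) :+ (con (+ 2) :+ g)) refl x (+ (2 * suc k)))
           (cong (λ g → move x false ℤ.+ g) (sym (twice-suc (suc k)))))
  apart-step true  false = separate k (separated true false)
    (trans (cong (λ g → (x ℤ.+ g) ℤ.- ℤ.1ℤ) (twice-suc k))
           (solve 2 (λ x g → (x :+ (con (+ 2) :+ g)) :- con (+ 1) := (x :+ con (+ 1)) :+ g) refl x (+ (2 * k))))

starStep : ℕ → ℕ → Step3 → Maybe (ℕ × ℕ)
starStep i j (a , b , c) = zip (gapStep i a b) (gapStep j b c)

data HalfGaps : Pos → ℕ → ℕ → Set where
  halfGaps : ∀ x i j → HalfGaps (x , x ℤ.+ + (2 * i) , x ℤ.+ + (2 * i) ℤ.+ + (2 * j)) i j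

halfGaps-≡ : ∀ {x y z} i j → y ≡ x ℤ.+ + (2 * i) → z ≡ y ℤ.+ + (2 * j) → HalfGaps (x , y , z) i j
halfGaps-≡ {x} i j refl refl = halfGaps x i j

star-halfGaps : ∀ i j → HalfGaps (star i j) i j
star-halfGaps i j = halfGaps-≡ i j (sym (ℤP.+-identityˡ (+ (2 * i)))) (cong +_ (ℕP.*-distribˡ-+ 2 i j))

data StarStep (p : Pos) (s : Step3) : Maybe (ℕ × ℕ) → Set where
  separate : ∀ {i′ j′} → HalfGaps (step p s) i′ j′ → meetOK p (step p s) ≡ true →
             StarStep p s (just (i′ , j′))
  collide  : meetOK p (step p s) ≡ false → StarStep p s nothing

starStep-spec : ∀ {p i j} → HalfGaps p i j → ∀ s → StarStep p s (starStep i j s)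
starStep-spec (halfGaps x i j) (a , b , c)
  with gapStep i a b | gapStep-spec x i a b | gapStep j b c | gapStep-spec (x ℤ.+ + (2 * i)) j b c
... | just _  | separate _ m₁ e₁ | just _  | separate _ m₂ e₂ = separate (halfGaps-≡ _ _ e₁ e₂) (cong₂ _∧_ m₁ m₂)
... | just _  | separate _ m₁ _  | nothing | collide m₂       = collide (cong₂ _∧_ m₁ m₂)
... | nothing | collide m₁       | _       | _                = collide (cong₂ _∧_ m₁ refl)

gapStep-to-zero : ∀ i a b → gapStep i a b ≡ just 0 → a ≡ true × b ≡ false
gapStep-to-zero (suc zero) true  false _ = refl , refl
gapStep-to-zero zero       false true  ()
gapStep-to-zero zero       true  _     ()
gapStep-to-zero zero       false false ()
gapStep-to-zero (suc _)    true  true  ()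
gapStep-to-zero (suc _)    false false ()
gapStep-to-zero (suc _)    false true  ()

zip-just : ∀ {A B : Set} {x : Maybe A} {y : Maybe B} {a b} → zip x y ≡ just (a , b) → x ≡ just a × y ≡ just b
zip-just {x = just _} {just _} refl = refl , refl

-- The middle walker would have to step down to meet the lower one and up to meet the upper one.
starStep-avoids-origin : ∀ i j s {i′ j′} → starStep i j s ≡ just (i′ , j′) → ¬ (i′ ≡ 0 × j′ ≡ 0)
starStep-avoids-origin i j (a , b , c) eq (refl , refl)
  with zip-just {x = gapStep i a b} eq
... | e₁ , e₂ with gapStep-to-zero i a b e₁ | gapStep-to-zero j b c e₂
... | _ , refl | () , _

countTrue : ∀ {A : Set} → (A → Bool) → List A → ℕ
countTrue P []       = 0
countTrue P (x ∷ xs) = if P x then suc (countTrue P xs) else countTrue P xs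

length-filter-countTrue : ∀ {A : Set} (P : A → Bool) (P? : ∀ x → Dec (T (P x))) xs →
                          length (filter P? xs) ≡ countTrue P xs
length-filter-countTrue P P? []       = refl
length-filter-countTrue P P? (x ∷ xs) with P x | P? x
... | true  | yes _ = cong suc (length-filter-countTrue P P? xs)
... | true  | no ¬p = ⊥-elim (¬p _)
... | false | no _  = length-filter-countTrue P P? xs

countTrue-++ : ∀ {A : Set} (P : A → Bool) xs ys → countTrue P (xs ++ ys) ≡ countTrue P xs + countTrue P ys
countTrue-++ P []       ys = refl
countTrue-++ P (x ∷ xs) ys with P x
... | true  = cong suc (countTrue-++ P xs ys)
... | false = countTrue-++ P xs ys

countTrue-map : ∀ {A B : Set} (P : B → Bool) (f : A → B) xs → countTrue P (map f xs) ≡ countTrue (λ x → P (f x)) xs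
countTrue-map P f []       = refl
countTrue-map P f (x ∷ xs) with P (f x)
... | true  = cong suc (countTrue-map P f xs)
... | false = countTrue-map P f xs

countTrue-cong : ∀ {A : Set} {P Q : A → Bool} → (∀ x → P x ≡ Q x) → ∀ xs → countTrue P xs ≡ countTrue Q xs
countTrue-cong P≡Q []       = refl
countTrue-cong {P = P} {Q} P≡Q (x ∷ xs) rewrite P≡Q x = cong (λ n → if Q x then suc n else n) (countTrue-cong P≡Q xs)

countTrue-none : ∀ {A : Set} {P : A → Bool} → (∀ x → P x ≡ false) → ∀ xs → countTrue P xs ≡ 0
countTrue-none none []       = refl
countTrue-none {P = P} none (x ∷ xs) rewrite none x = countTrue-none none xs

Σsteps : ∀ {A : Set} → (A → A → A) → A → (Step3 → A) → A
Σsteps _+_ 0# f = foldr (λ s acc → f s + acc) 0# allStep3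

Σsteps-cong : ∀ {A : Set} {_+_ : A → A → A} {0# : A} {f g : Step3 → A} → (∀ s → f s ≡ g s) →
              Σsteps _+_ 0# f ≡ Σsteps _+_ 0# g
Σsteps-cong {_+_ = _+_} {0#} {f} {g} f≡g = go allStep3
  where
  go : ∀ ss → foldr (λ s acc → f s + acc) 0# ss ≡ foldr (λ s acc → g s + acc) 0# ss
  go []       = refl
  go (s ∷ ss) = cong₂ _+_ (f≡g s) (go ss)

countTrue-concatMap : ∀ {A B : Set} (P : B → Bool) (f : A → List B) xs →
                      countTrue P (concatMap f xs) ≡ foldr (λ x acc → countTrue P (f x) + acc) 0 xs
countTrue-concatMap P f []       = refl
countTrue-concatMap P f (x ∷ xs) = trans (countTrue-++ P (f x) (concatMap f xs))
                                         (cong (λ m → countTrue P (f x) + m) (countTrue-concatMap P f xs))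

countBy-countTrue : ∀ P n → countBy P n ≡ countTrue P (allSeqs n)
countBy-countTrue P n = length-filter-countTrue P _ (allSeqs n)

countTrue-allSeqs-suc : ∀ P n → countTrue P (allSeqs (suc n)) ≡ Σsteps _+_ 0 (λ s → countTrue (λ w → P (s ∷ w)) (allSeqs n))
countTrue-allSeqs-suc P n = trans (countTrue-concatMap P (λ s → map (s ∷_) (allSeqs n)) allStep3)
                                  (Σsteps-cong {_+_ = _+_} {0} (λ s → countTrue-map P (s ∷_) (allSeqs n)))

sumSuccessors : ∀ {A : Set} → (A → A → A) → A → (ℕ → ℕ → A) → ℕ → ℕ → A
sumSuccessors _+_ 0# f i j = Σsteps _+_ 0# (λ s → maybe′ (uncurry f) 0# (starStep i j s))

oscByGaps : ℕ → ℕ → ℕ → ℕ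
oscByGaps zero    i j = 1
oscByGaps (suc n) i j = sumSuccessors _+_ 0 (oscByGaps n) i j

vicByGaps : ℕ → ℕ → ℕ → ℕ
vicByGaps n       zero    j       = 0
vicByGaps n       (suc k) zero    = 0
vicByGaps zero    (suc k) (suc l) = 1
vicByGaps (suc n) (suc k) (suc l) = sumSuccessors _+_ 0 (vicByGaps n) (suc k) (suc l)

<b-+twice : ∀ x i → (x <b (x ℤ.+ + (2 * i))) ≡ (0 ℕ.<ᵇ i)
<b-+twice x zero    = ≤ᵇ-false (x ℤ.+ ℤ.1ℤ) (x ℤ.+ + 0) 0 (cong (ℤ._+ ℤ.1ℤ) (sym (ℤP.+-identityʳ x)))
<b-+twice x (suc k) = ≤ᵇ-true (x ℤ.+ ℤ.1ℤ) (x ℤ.+ + (2 * suc k)) (k + 1 * suc k)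
                               (sym (ℤP.+-assoc x ℤ.1ℤ (+ (k + 1 * suc k))))

nonCrossingAt-halfGaps : ∀ {p i j} → HalfGaps p i j → nonCrossingAt p ≡ true
nonCrossingAt-halfGaps (halfGaps x i j) = cong₂ _∧_ (≤ᵇ-true x _ (2 * i) refl) (≤ᵇ-true (x ℤ.+ + (2 * i)) _ (2 * j) refl)

strictAt-halfGaps : ∀ {p i j} → HalfGaps p i j → strictAt p ≡ (0 ℕ.<ᵇ i) ∧ (0 ℕ.<ᵇ j)
strictAt-halfGaps (halfGaps x i j) = cong₂ _∧_ (<b-+twice x i) (<b-+twice (x ℤ.+ + (2 * i)) j)

countTrue-osculating : ∀ n {p i j} → HalfGaps p i j → countTrue (osculating p) (allSeqs n) ≡ oscByGaps n i j
countTrue-osculating zero g = cong (λ b → if b then 1 else 0) (nonCrossingAt-halfGaps g)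
countTrue-osculating (suc n) {p} {i} {j} g =
  trans (countTrue-allSeqs-suc (osculating p) n) (Σsteps-cong {_+_ = _+_} {0} branch)
  where
  branch : ∀ s → countTrue (λ w → osculating p (s ∷ w)) (allSeqs n)
                 ≡ maybe′ (uncurry (oscByGaps n)) 0 (starStep i j s)
  branch s with starStep i j s | starStep-spec g s
  ... | just (i′ , j′) | separate g′ m = trans (countTrue-cong continue (allSeqs n)) (countTrue-osculating n g′)
    where
    continue : ∀ w → osculating p (s ∷ w) ≡ osculating (step p s) w
    continue w = cong₂ (λ a b → a ∧ b ∧ osculating (step p s) w) (nonCrossingAt-halfGaps g) m
  ... | nothing | collide m = countTrue-none blocked (allSeqs n)
    where
    blocked : ∀ w → osculating p (s ∷ w) ≡ false
    blocked w = cong₂ (λ a b → a ∧ b ∧ osculating (step p s) w) (nonCrossingAt-halfGaps g) m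

meetOK-positive : ∀ {p k l} → HalfGaps p (suc k) (suc l) → ∀ p′ → meetOK p p′ ≡ true
meetOK-positive (halfGaps x (suc k) (suc l)) (x′ , y′ , z′) =
  cong₂ _∧_ (apart x y x′ y′ (==b-+suc x (k + 1 * suc k))) (apart y (y ℤ.+ + (2 * suc l)) y′ z′ (==b-+suc y (l + 1 * suc l)))
  where
  y : ℤ
  y = x ℤ.+ + (2 * suc k)

vicious-blocked : ∀ {p} → strictAt p ≡ false → ∀ w → vicious p w ≡ false
vicious-blocked e []          = e
vicious-blocked {p} e (s ∷ w) = cong (_∧ vicious (step p s) w) e

countTrue-vicious : ∀ n {p i j} → HalfGaps p i j → countTrue (vicious p) (allSeqs n) ≡ vicByGaps n i j
countTrue-vicious n {i = zero} g = countTrue-none (vicious-blocked (strictAt-halfGaps g)) (allSeqs n)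
countTrue-vicious n {i = suc k} {zero} g = countTrue-none (vicious-blocked (strictAt-halfGaps g)) (allSeqs n)
countTrue-vicious zero {i = suc k} {suc l} g = cong (λ b → if b then 1 else 0) (strictAt-halfGaps g)
countTrue-vicious (suc n) {p} {suc k} {suc l} g =
  trans (countTrue-allSeqs-suc (vicious p) n) (Σsteps-cong {_+_ = _+_} {0} branch)
  where
  branch : ∀ s → countTrue (λ w → vicious p (s ∷ w)) (allSeqs n)
                 ≡ maybe′ (uncurry (vicByGaps n)) 0 (starStep (suc k) (suc l) s)
  branch s with starStep (suc k) (suc l) s | starStep-spec g s
  ... | just (i′ , j′) | separate g′ _ = trans (countTrue-cong continue (allSeqs n)) (countTrue-vicious n g′)
    where
    continue : ∀ w → vicious p (s ∷ w) ≡ vicious (step p s) w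
    continue w = cong (_∧ vicious (step p s) w) (strictAt-halfGaps g)
  ... | nothing | collide m with trans (sym (meetOK-positive g (step p s))) m
  ... | ()

-- Formal power series

shift : PS → PS
shift F n = F (suc n)

κ0-coeff : ∀ n → κ 0ℚ n ≡ 0ℚ
κ0-coeff zero    = refl
κ0-coeff (suc n) = refl

⊛-coeff-zero : ∀ F G → (F ⊛ G) 0 ≡ F 0 ℚ.* G 0
⊛-coeff-zero F G = ℚP.+-identityʳ _

⊛-coeff-suc : ∀ F G n → (F ⊛ G) (suc n) ≡ F 0 ℚ.* G (suc n) ℚ.+ (shift F ⊛ G) n
⊛-coeff-suc F G n = cong (F 0 ℚ.* G (suc n) ℚ.+_) (begin
  Σℚ (map h (applyUpTo suc (suc n)))    ≡⟨ cong Σℚ (map-applyUpTo suc h (suc n)) ⟩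
  Σℚ (applyUpTo (λ k → h (suc k)) (suc n)) ≡⟨ cong Σℚ (map-applyUpTo id (λ k → F (suc k) ℚ.* G (n ℕ.∸ k)) (suc n)) ⟨
  (shift F ⊛ G) n                       ∎)
  where
  Σℚ : List ℚ → ℚ
  Σℚ = foldr ℚ._+_ 0ℚ
  h : ℕ → ℚ
  h k = F k ℚ.* G (suc n ℕ.∸ k)

⊛-cong : ∀ {F F′ G G′} → F ≈ F′ → G ≈ G′ → F ⊛ G ≈ F′ ⊛ G′
⊛-cong {F} {F′} {G} {G′} F≈ G≈ zero = begin
  (F ⊛ G) 0      ≡⟨ ⊛-coeff-zero F G ⟩
  F 0 ℚ.* G 0    ≡⟨ cong₂ ℚ._*_ (F≈ 0) (G≈ 0) ⟩
  F′ 0 ℚ.* G′ 0  ≡⟨ ⊛-coeff-zero F′ G′ ⟨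
  (F′ ⊛ G′) 0    ∎
⊛-cong {F} {F′} {G} {G′} F≈ G≈ (suc n) = begin
  (F ⊛ G) (suc n)                                   ≡⟨ ⊛-coeff-suc F G n ⟩
  F 0 ℚ.* G (suc n) ℚ.+ (shift F ⊛ G) n             ≡⟨ cong₂ ℚ._+_ (cong₂ ℚ._*_ (F≈ 0) (G≈ (suc n)))
                                                               (⊛-cong {shift F} {shift F′} (λ m → F≈ (suc m)) G≈ n) ⟩
  F′ 0 ℚ.* G′ (suc n) ℚ.+ (shift F′ ⊛ G′) n         ≡⟨ ⊛-coeff-suc F′ G′ n ⟨
  (F′ ⊛ G′) (suc n)                                 ∎

module _ where
  open ℚ-Solver

  ⊛-distribʳ : ∀ F G H → (F ⊕ G) ⊛ H ≈ F ⊛ H ⊕ G ⊛ H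
  ⊛-distribʳ F G H zero = begin
    ((F ⊕ G) ⊛ H) 0                ≡⟨ ⊛-coeff-zero (F ⊕ G) H ⟩
    (F 0 ℚ.+ G 0) ℚ.* H 0          ≡⟨ ℚP.*-distribʳ-+ (H 0) (F 0) (G 0) ⟩
    F 0 ℚ.* H 0 ℚ.+ G 0 ℚ.* H 0    ≡⟨ cong₂ ℚ._+_ (⊛-coeff-zero F H) (⊛-coeff-zero G H) ⟨
    (F ⊛ H ⊕ G ⊛ H) 0              ∎
  ⊛-distribʳ F G H (suc n) = begin
    ((F ⊕ G) ⊛ H) (suc n)
      ≡⟨ ⊛-coeff-suc (F ⊕ G) H n ⟩
    (F 0 ℚ.+ G 0) ℚ.* H (suc n) ℚ.+ (shift (F ⊕ G) ⊛ H) n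
      ≡⟨ cong ((F 0 ℚ.+ G 0) ℚ.* H (suc n) ℚ.+_) (⊛-distribʳ (shift F) (shift G) H n) ⟩
    (F 0 ℚ.+ G 0) ℚ.* H (suc n) ℚ.+ ((shift F ⊛ H) n ℚ.+ (shift G ⊛ H) n)
      ≡⟨ solve 5 (λ a b h x y → (a :+ b) :* h :+ (x :+ y) := (a :* h :+ x) :+ (b :* h :+ y))
               refl (F 0) (G 0) (H (suc n)) ((shift F ⊛ H) n) ((shift G ⊛ H) n) ⟩
    (F 0 ℚ.* H (suc n) ℚ.+ (shift F ⊛ H) n) ℚ.+ (G 0 ℚ.* H (suc n) ℚ.+ (shift G ⊛ H) n)
      ≡⟨ cong₂ ℚ._+_ (⊛-coeff-suc F H n) (⊛-coeff-suc G H n) ⟨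
    (F ⊛ H ⊕ G ⊛ H) (suc n)
      ∎

  ⊛-coeff-sucʳ : ∀ F G n → (F ⊛ G) (suc n) ≡ F (suc n) ℚ.* G 0 ℚ.+ (F ⊛ shift G) n
  ⊛-coeff-sucʳ F G zero = begin
    (F ⊛ G) 1                       ≡⟨ ⊛-coeff-suc F G 0 ⟩
    F 0 ℚ.* G 1 ℚ.+ (shift F ⊛ G) 0  ≡⟨ cong (F 0 ℚ.* G 1 ℚ.+_) (⊛-coeff-zero (shift F) G) ⟩
    F 0 ℚ.* G 1 ℚ.+ F 1 ℚ.* G 0      ≡⟨ ℚP.+-comm (F 0 ℚ.* G 1) (F 1 ℚ.* G 0) ⟩
    F 1 ℚ.* G 0 ℚ.+ F 0 ℚ.* G 1      ≡⟨ cong (F 1 ℚ.* G 0 ℚ.+_) (⊛-coeff-zero F (shift G)) ⟨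
    F 1 ℚ.* G 0 ℚ.+ (F ⊛ shift G) 0  ∎
  ⊛-coeff-sucʳ F G (suc n) = begin
    (F ⊛ G) (suc (suc n))
      ≡⟨ ⊛-coeff-suc F G (suc n) ⟩
    F 0 ℚ.* G (suc (suc n)) ℚ.+ (shift F ⊛ G) (suc n)
      ≡⟨ cong (F 0 ℚ.* G (suc (suc n)) ℚ.+_) (⊛-coeff-sucʳ (shift F) G n) ⟩
    F 0 ℚ.* G (suc (suc n)) ℚ.+ (F (suc (suc n)) ℚ.* G 0 ℚ.+ (shift F ⊛ shift G) n)
      ≡⟨ solve 3 (λ a b x → a :+ (b :+ x) := b :+ (a :+ x)) refl
               (F 0 ℚ.* G (suc (suc n))) (F (suc (suc n)) ℚ.* G 0) ((shift F ⊛ shift G) n) ⟩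
    F (suc (suc n)) ℚ.* G 0 ℚ.+ (F 0 ℚ.* G (suc (suc n)) ℚ.+ (shift F ⊛ shift G) n)
      ≡⟨ cong (F (suc (suc n)) ℚ.* G 0 ℚ.+_) (⊛-coeff-suc F (shift G) n) ⟨
    F (suc (suc n)) ℚ.* G 0 ℚ.+ (F ⊛ shift G) (suc n)
      ∎

  ⊛-comm : ∀ F G → F ⊛ G ≈ G ⊛ F
  ⊛-comm F G zero = begin
    (F ⊛ G) 0     ≡⟨ ⊛-coeff-zero F G ⟩
    F 0 ℚ.* G 0   ≡⟨ ℚP.*-comm (F 0) (G 0) ⟩
    G 0 ℚ.* F 0   ≡⟨ ⊛-coeff-zero G F ⟨
    (G ⊛ F) 0     ∎
  ⊛-comm F G (suc n) = begin
    (F ⊛ G) (suc n)                            ≡⟨ ⊛-coeff-suc F G n ⟩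
    F 0 ℚ.* G (suc n) ℚ.+ (shift F ⊛ G) n      ≡⟨ cong₂ ℚ._+_ (ℚP.*-comm (F 0) (G (suc n))) (⊛-comm (shift F) G n) ⟩
    G (suc n) ℚ.* F 0 ℚ.+ (G ⊛ shift F) n      ≡⟨ ⊛-coeff-sucʳ G F n ⟨
    (G ⊛ F) (suc n)                            ∎

  ·-⊛ : ∀ a F G → (a · F) ⊛ G ≈ a · (F ⊛ G)
  ·-⊛ a F G zero = begin
    ((a · F) ⊛ G) 0        ≡⟨ ⊛-coeff-zero (a · F) G ⟩
    a ℚ.* F 0 ℚ.* G 0      ≡⟨ ℚP.*-assoc a (F 0) (G 0) ⟩
    a ℚ.* (F 0 ℚ.* G 0)    ≡⟨ cong (a ℚ.*_) (⊛-coeff-zero F G) ⟨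
    (a · (F ⊛ G)) 0        ∎
  ·-⊛ a F G (suc n) = begin
    ((a · F) ⊛ G) (suc n)
      ≡⟨ ⊛-coeff-suc (a · F) G n ⟩
    a ℚ.* F 0 ℚ.* G (suc n) ℚ.+ ((a · shift F) ⊛ G) n
      ≡⟨ cong (a ℚ.* F 0 ℚ.* G (suc n) ℚ.+_) (·-⊛ a (shift F) G n) ⟩
    a ℚ.* F 0 ℚ.* G (suc n) ℚ.+ a ℚ.* (shift F ⊛ G) n
      ≡⟨ solve 4 (λ a f g x → a :* f :* g :+ a :* x := a :* (f :* g :+ x)) refl a (F 0) (G (suc n)) ((shift F ⊛ G) n) ⟩
    a ℚ.* (F 0 ℚ.* G (suc n) ℚ.+ (shift F ⊛ G) n)
      ≡⟨ cong (a ℚ.*_) (⊛-coeff-suc F G n) ⟨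
    (a · (F ⊛ G)) (suc n)
      ∎

  ⊛-assoc : ∀ F G H → (F ⊛ G) ⊛ H ≈ F ⊛ (G ⊛ H)
  ⊛-assoc F G H zero = begin
    ((F ⊛ G) ⊛ H) 0            ≡⟨ ⊛-coeff-zero (F ⊛ G) H ⟩
    (F ⊛ G) 0 ℚ.* H 0          ≡⟨ cong (ℚ._* H 0) (⊛-coeff-zero F G) ⟩
    F 0 ℚ.* G 0 ℚ.* H 0        ≡⟨ ℚP.*-assoc (F 0) (G 0) (H 0) ⟩
    F 0 ℚ.* (G 0 ℚ.* H 0)      ≡⟨ cong (F 0 ℚ.*_) (⊛-coeff-zero G H) ⟨
    F 0 ℚ.* (G ⊛ H) 0          ≡⟨ ⊛-coeff-zero F (G ⊛ H) ⟨
    (F ⊛ (G ⊛ H)) 0            ∎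
  ⊛-assoc F G H (suc n) = begin
    ((F ⊛ G) ⊛ H) (suc n)
      ≡⟨ ⊛-coeff-suc (F ⊛ G) H n ⟩
    (F ⊛ G) 0 ℚ.* H (suc n) ℚ.+ (shift (F ⊛ G) ⊛ H) n
      ≡⟨ cong₂ ℚ._+_ (cong (ℚ._* H (suc n)) (⊛-coeff-zero F G))
                     (⊛-cong {G = H} (⊛-coeff-suc F G) (λ _ → refl) n) ⟩
    F 0 ℚ.* G 0 ℚ.* H (suc n) ℚ.+ ((F 0 · shift G ⊕ shift F ⊛ G) ⊛ H) n
      ≡⟨ cong (F 0 ℚ.* G 0 ℚ.* H (suc n) ℚ.+_) (⊛-distribʳ (F 0 · shift G) (shift F ⊛ G) H n) ⟩
    F 0 ℚ.* G 0 ℚ.* H (suc n) ℚ.+ (((F 0 · shift G) ⊛ H) n ℚ.+ ((shift F ⊛ G) ⊛ H) n)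
      ≡⟨ cong (F 0 ℚ.* G 0 ℚ.* H (suc n) ℚ.+_) (cong₂ ℚ._+_ (·-⊛ (F 0) (shift G) H n) (⊛-assoc (shift F) G H n)) ⟩
    F 0 ℚ.* G 0 ℚ.* H (suc n) ℚ.+ (F 0 ℚ.* (shift G ⊛ H) n ℚ.+ (shift F ⊛ (G ⊛ H)) n)
      ≡⟨ solve 5 (λ f g h x y → f :* g :* h :+ (f :* x :+ y) := f :* (g :* h :+ x) :+ y) refl
               (F 0) (G 0) (H (suc n)) ((shift G ⊛ H) n) ((shift F ⊛ (G ⊛ H)) n) ⟩
    F 0 ℚ.* (G 0 ℚ.* H (suc n) ℚ.+ (shift G ⊛ H) n) ℚ.+ (shift F ⊛ (G ⊛ H)) n
      ≡⟨ cong (λ z → F 0 ℚ.* z ℚ.+ (shift F ⊛ (G ⊛ H)) n) (⊛-coeff-suc G H n) ⟨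
    F 0 ℚ.* (G ⊛ H) (suc n) ℚ.+ (shift F ⊛ (G ⊛ H)) n
      ≡⟨ ⊛-coeff-suc F (G ⊛ H) n ⟨
    (F ⊛ (G ⊛ H)) (suc n)
      ∎

  κ-⊛ : ∀ a F → κ a ⊛ F ≈ a · F
  κ-⊛ a F zero    = ⊛-coeff-zero (κ a) F
  κ-⊛ a F (suc n) = begin
    (κ a ⊛ F) (suc n)                              ≡⟨ ⊛-coeff-suc (κ a) F n ⟩
    a ℚ.* F (suc n) ℚ.+ (shift (κ a) ⊛ F) n
      ≡⟨ cong (a ℚ.* F (suc n) ℚ.+_) (⊛-cong {G = F} (λ k → sym (κ0-coeff k)) (λ _ → refl) n) ⟩
    a ℚ.* F (suc n) ℚ.+ (κ 0ℚ ⊛ F) n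
      ≡⟨ cong (a ℚ.* F (suc n) ℚ.+_) (trans (κ-⊛ 0ℚ F n) (ℚP.*-zeroˡ (F n))) ⟩
    a ℚ.* F (suc n) ℚ.+ 0ℚ                         ≡⟨ ℚP.+-identityʳ _ ⟩
    a ℚ.* F (suc n)                                ∎

negate : PS → PS
negate F n = ℚ.- F n

κ1-⊛ : ∀ F → κ 1ℚ ⊛ F ≈ F
κ1-⊛ F n = trans (κ-⊛ 1ℚ F n) (ℚP.*-identityˡ (F n))

PS-commutativeRing : CommutativeRing _ _
PS-commutativeRing = record
  { Carrier = PS ; _≈_ = _≈_ ; _+_ = _⊕_ ; _*_ = _⊛_ ; -_ = negate ; 0# = κ 0ℚ ; 1# = κ 1ℚ
  ; isCommutativeRing = record
    { isRing = record
      { +-isAbelianGroup = record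
        { isGroup = record
          { isMonoid = record
            { isSemigroup = record
              { isMagma = record
                { isEquivalence = record { refl = λ _ → refl ; sym = λ e n → sym (e n) ; trans = λ e f n → trans (e n) (f n) }
                ; ∙-cong = λ e f n → cong₂ ℚ._+_ (e n) (f n) }
              ; assoc = λ F G H n → ℚP.+-assoc (F n) (G n) (H n) }
            ; identity = (λ F n → trans (cong (ℚ._+ F n) (κ0-coeff n)) (ℚP.+-identityˡ (F n)))
                       , (λ F n → trans (cong (F n ℚ.+_) (κ0-coeff n)) (ℚP.+-identityʳ (F n))) }
          ; inverse = (λ F n → trans (ℚP.+-inverseˡ (F n)) (sym (κ0-coeff n)))
                    , (λ F n → trans (ℚP.+-inverseʳ (F n)) (sym (κ0-coeff n)))
          ; ⁻¹-cong = λ e n → cong ℚ.-_ (e n) }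
        ; comm = λ F G n → ℚP.+-comm (F n) (G n) }
      ; *-cong = ⊛-cong
      ; *-assoc = ⊛-assoc
      ; *-identity = κ1-⊛ , (λ F n → trans (⊛-comm F (κ 1ℚ) n) (κ1-⊛ F n))
      ; distrib = (λ F G H n → trans (⊛-comm F (G ⊕ H) n)
                                 (trans (⊛-distribʳ G H F n) (cong₂ ℚ._+_ (⊛-comm G F n) (⊛-comm H F n))))
                , (λ F G H → ⊛-distribʳ G H F) }
    ; *-comm = ⊛-comm } }

ιℤ : ℤ → ℚ
ιℤ z = z ℚ./ 1

ιℤ-mkℚ : ∀ z → ιℤ z ≡ mkℚ z 0 (coprime-sym (1-coprimeTo ℤ.∣ z ∣))
ιℤ-mkℚ (+ n)    = ℚP.normalize-coprime {n} {0} (coprime-sym (1-coprimeTo n))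
ιℤ-mkℚ -[1+ n ] = cong ℚ.-_ (ℚP.normalize-coprime {suc n} {0} (coprime-sym (1-coprimeTo (suc n))))

ιℤ-+ : ∀ a b → ιℤ (a ℤ.+ b) ≡ ιℤ a ℚ.+ ιℤ b
ιℤ-+ a b = trans (cong ιℤ (cong₂ ℤ._+_ (sym (ℤP.*-identityʳ a)) (sym (ℤP.*-identityʳ b))))
                 (sym (cong₂ ℚ._+_ (ιℤ-mkℚ a) (ιℤ-mkℚ b)))

ιℤ-* : ∀ a b → ιℤ (a ℤ.* b) ≡ ιℤ a ℚ.* ιℤ b
ιℤ-* a b = sym (cong₂ ℚ._*_ (ιℤ-mkℚ a) (ιℤ-mkℚ b))

ιℤ-neg : ∀ a → ιℤ (ℤ.- a) ≡ ℚ.- ιℤ a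
ιℤ-neg (+ zero)  = refl
ιℤ-neg (+ suc n) = refl
ιℤ-neg -[1+ n ]  = trans (ιℤ-mkℚ (+ suc n)) (sym (cong ℚ.-_ (ιℤ-mkℚ -[1+ n ])))

κ-+ : ∀ a b → κ (a ℚ.+ b) ≈ κ a ⊕ κ b
κ-+ a b zero    = refl
κ-+ a b (suc n) = sym (ℚP.+-identityʳ 0ℚ)

κ-* : ∀ a b → κ (a ℚ.* b) ≈ κ a ⊛ κ b
κ-* a b n = sym (trans (κ-⊛ a (κ b) n) (coeff n))
  where
  coeff : ∀ n → a ℚ.* κ b n ≡ κ (a ℚ.* b) n
  coeff zero    = refl
  coeff (suc n) = ℚP.*-zeroʳ a

κ-neg : ∀ a → κ (ℚ.- a) ≈ negate (κ a)
κ-neg a zero    = refl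
κ-neg a (suc n) = refl

PS-almostCommutativeRing : ACR.AlmostCommutativeRing _ _
PS-almostCommutativeRing = ACR.fromCommutativeRing PS-commutativeRing

ℤ⟶PS : ℤ.+-*-rawRing ACR.-Raw-AlmostCommutative⟶ PS-almostCommutativeRing
ℤ⟶PS = record
  { ⟦_⟧    = λ z → κ (ιℤ z)
  ; +-homo = λ a b n → trans (cong (λ q → κ q n) (ιℤ-+ a b)) (κ-+ (ιℤ a) (ιℤ b) n)
  ; *-homo = λ a b n → trans (cong (λ q → κ q n) (ιℤ-* a b)) (κ-* (ιℤ a) (ιℤ b) n)
  ; -‿homo = λ a n → trans (cong (λ q → κ q n) (ιℤ-neg a)) (κ-neg (ιℤ a) n)
  ; 0-homo = λ n → refl
  ; 1-homo = λ n → refl }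

equal-coefficients? : ∀ a b → Maybe (κ (ιℤ a) ≈ κ (ιℤ b))
equal-coefficients? a b with a ℤ.≟ b
... | yes refl = just (λ n → refl)
... | no _     = nothing

module PS-Solver = Algebra.Solver.Ring ℤ.+-*-rawRing PS-almostCommutativeRing ℤ⟶PS equal-coefficients?

open PS-Solver using (solve; _:=_; Polynomial; con; _:+_; _:*_; _:-_; :-_)

-- # n denotes κ (ιℤ (+ n)), which is c n by definition.
infix 9 #_
#_ : ∀ {m} → ℕ → Polynomial m
# n = con (+ n)

-- An equation between series holding modulo hypotheses a ≈ b: the ring solver
-- certifies that L − R is the combination Σ P ⊛ (a ⊖ b) of the hypotheses.
WeightedEquation : Set
WeightedEquation = PS × PS × PS

Holds : WeightedEquation → Set
Holds (_ , a , b) = a ≈ b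

combination : List WeightedEquation → PS
combination []                 = κ 0ℚ
combination ((P , a , b) ∷ hs) = P ⊛ (a ⊖ b) ⊕ combination hs

combination-≈0 : ∀ hs → All Holds hs → combination hs ≈ κ 0ℚ
combination-≈0 []                 []         = λ _ → refl
combination-≈0 ((P , a , b) ∷ hs) (a≈b ∷ ok) n = begin
  (P ⊛ (a ⊖ b)) n ℚ.+ combination hs n
    ≡⟨ cong₂ ℚ._+_ (⊛-cong {P} (λ _ → refl) (λ m → cong (ℚ._- b m) (a≈b m)) n) (combination-≈0 hs ok n) ⟩
  (P ⊛ (b ⊖ b)) n ℚ.+ κ 0ℚ n
    ≡⟨ solve 2 (λ P b → P :* (b :- b) :+ # 0 := # 0) (λ _ → refl) P b n ⟩
  κ 0ℚ n
    ∎

≈-by-combination : ∀ {L R} hs → L ≈ R ⊕ combination hs → All Holds hs → L ≈ R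
≈-by-combination {L} {R} hs L≈ ok n = begin
  L n                              ≡⟨ L≈ n ⟩
  R n ℚ.+ combination hs n         ≡⟨ cong (R n ℚ.+_) (combination-≈0 hs ok n) ⟩
  R n ℚ.+ κ 0ℚ n                   ≡⟨ cong (R n ℚ.+_) (κ0-coeff n) ⟩
  R n ℚ.+ 0ℚ                       ≡⟨ ℚP.+-identityʳ (R n) ⟩
  R n                              ∎

tt-⊛-coeff-zero : ∀ F → (tt ⊛ F) 0 ≡ 0ℚ
tt-⊛-coeff-zero F = trans (⊛-coeff-zero tt F) (ℚP.*-zeroˡ (F 0))

tt-⊛-coeff-suc : ∀ F n → (tt ⊛ F) (suc n) ≡ F n
tt-⊛-coeff-suc F n = begin
  (tt ⊛ F) (suc n)                   ≡⟨ ⊛-coeff-suc tt F n ⟩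
  0ℚ ℚ.* F (suc n) ℚ.+ (shift tt ⊛ F) n ≡⟨ cong₂ ℚ._+_ (ℚP.*-zeroˡ (F (suc n)))
                                                      (⊛-cong {shift tt} {κ 1ℚ} {F} shift-tt (λ _ → refl) n) ⟩
  0ℚ ℚ.+ (κ 1ℚ ⊛ F) n                ≡⟨ ℚP.+-identityˡ ((κ 1ℚ ⊛ F) n) ⟩
  (κ 1ℚ ⊛ F) n                       ≡⟨ κ1-⊛ F n ⟩
  F n                                ∎
  where
  shift-tt : shift tt ≈ κ 1ℚ
  shift-tt zero    = refl
  shift-tt (suc k) = refl

one-plus-tt-coeff-zero : ∀ G H → G ≈ κ 1ℚ ⊕ tt ⊛ H → G 0 ≡ 1ℚ
one-plus-tt-coeff-zero G H G≈ = trans (G≈ 0) (trans (cong (1ℚ ℚ.+_) (tt-⊛-coeff-zero H)) (ℚP.+-identityʳ 1ℚ))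

one-plus-tt-coeff-suc : ∀ G H → G ≈ κ 1ℚ ⊕ tt ⊛ H → ∀ n → G (suc n) ≡ H n
one-plus-tt-coeff-suc G H G≈ n = trans (G≈ (suc n)) (trans (cong (0ℚ ℚ.+_) (tt-⊛-coeff-suc H n)) (ℚP.+-identityˡ (H n)))

^^-+ : ∀ F m n → F ^^ (m + n) ≈ F ^^ m ⊛ F ^^ n
^^-+ F zero    n k = sym (κ1-⊛ (F ^^ n) k)
^^-+ F (suc m) n k = trans (⊛-cong {F} (λ _ → refl) (^^-+ F m n) k) (sym (⊛-assoc F (F ^^ m) (F ^^ n) k))

geometric : ℚ → PS
geometric a zero    = 1ℚ
geometric a (suc n) = a ℚ.* geometric a n

geometric-unfold : ∀ a → geometric a ≈ c 1 ⊕ κ a ⊛ (tt ⊛ geometric a)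
geometric-unfold a zero = sym (begin
  1ℚ ℚ.+ (κ a ⊛ (tt ⊛ geometric a)) 0   ≡⟨ cong (1ℚ ℚ.+_) (κ-⊛ a (tt ⊛ geometric a) 0) ⟩
  1ℚ ℚ.+ a ℚ.* (tt ⊛ geometric a) 0     ≡⟨ cong (λ x → 1ℚ ℚ.+ a ℚ.* x) (tt-⊛-coeff-zero (geometric a)) ⟩
  1ℚ ℚ.+ a ℚ.* 0ℚ                       ≡⟨ cong (1ℚ ℚ.+_) (ℚP.*-zeroʳ a) ⟩
  1ℚ ℚ.+ 0ℚ                             ≡⟨ ℚP.+-identityʳ 1ℚ ⟩
  1ℚ                                    ∎)
geometric-unfold a (suc n) = sym (begin
  0ℚ ℚ.+ (κ a ⊛ (tt ⊛ geometric a)) (suc n)   ≡⟨ ℚP.+-identityˡ _ ⟩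
  (κ a ⊛ (tt ⊛ geometric a)) (suc n)          ≡⟨ κ-⊛ a (tt ⊛ geometric a) (suc n) ⟩
  a ℚ.* (tt ⊛ geometric a) (suc n)            ≡⟨ cong (a ℚ.*_) (tt-⊛-coeff-suc (geometric a) n) ⟩
  a ℚ.* geometric a n                         ∎)

geometric-inverse : ∀ a → (c 1 ⊖ κ a ⊛ tt) ⊛ geometric a ≈ c 1
geometric-inverse a = ≈-by-combination ((c 1 , geometric a , c 1 ⊕ κ a ⊛ (tt ⊛ geometric a)) ∷ [])
  (solve 3 (λ a t G → (# 1 :- a :* t) :* G := # 1 :+ (# 1 :* (G :- (# 1 :+ a :* (t :* G))) :+ # 0))
         (λ _ → refl) (κ a) tt (geometric a))
  (geometric-unfold a ∷ [])

inv[1-8t] inv[1+t] : PS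
inv[1-8t] = geometric ℚ[ 8 ]
inv[1+t]  = geometric (ℚ.- 1ℚ)

inv[1-8t]-inverse : (c 1 ⊖ c 8 ⊛ tt) ⊛ inv[1-8t] ≈ c 1
inv[1-8t]-inverse = geometric-inverse ℚ[ 8 ]

inv[1+t]-inverse : (c 1 ⊕ tt) ⊛ inv[1+t] ≈ c 1
inv[1+t]-inverse = ≈-by-combination ((c 1 , (c 1 ⊖ κ (ℚ.- 1ℚ) ⊛ tt) ⊛ inv[1+t] , c 1) ∷ [])
  (solve 2 (λ t G → (# 1 :+ t) :* G := # 1 :+ (# 1 :* ((# 1 :- con (ℤ.- + 1) :* t) :* G :- # 1) :+ # 0))
         (λ _ → refl) tt inv[1+t])
  (geometric-inverse (ℚ.- 1ℚ) ∷ [])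

inv[1-8t]-inverseˡ : inv[1-8t] ⊛ (c 1 ⊖ c 8 ⊛ tt) ≈ c 1
inv[1-8t]-inverseˡ n = trans (⊛-comm inv[1-8t] (c 1 ⊖ c 8 ⊛ tt) n) (inv[1-8t]-inverse n)

inv[1+t]-inverseˡ : inv[1+t] ⊛ (c 1 ⊕ tt) ≈ c 1
inv[1+t]-inverseˡ n = trans (⊛-comm inv[1+t] (c 1 ⊕ tt) n) (inv[1+t]-inverse n)

cancel-invertible : ∀ {D D⁻¹ F G} → D⁻¹ ⊛ D ≈ c 1 → D ⊛ F ≈ D ⊛ G → F ≈ G
cancel-invertible {D} {D⁻¹} {F} {G} inverse DF≈DG = ≈-by-combination
  ((negate F , D⁻¹ ⊛ D , c 1) ∷ (G , D⁻¹ ⊛ D , c 1) ∷ (D⁻¹ , D ⊛ F , D ⊛ G) ∷ [])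
  (solve 4 (λ D D⁻¹ F G → F := G :+ ((:- F) :* (D⁻¹ :* D :- # 1)
                                   :+ (G :* (D⁻¹ :* D :- # 1) :+ (D⁻¹ :* (D :* F :- D :* G) :+ # 0))))
     (λ _ → refl) D D⁻¹ F G)
  (inverse ∷ inverse ∷ DF≈DG ∷ [])

⊛-coeff-vanishes : ∀ n D G → (∀ m → m ≤ n → D m ≡ 0ℚ) → (D ⊛ G) n ≡ 0ℚ
⊛-coeff-vanishes zero    D G D≡0 = trans (⊛-coeff-zero D G) (trans (cong (ℚ._* G 0) (D≡0 0 z≤n)) (ℚP.*-zeroˡ (G 0)))
⊛-coeff-vanishes (suc n) D G D≡0 = begin
  (D ⊛ G) (suc n)
    ≡⟨ ⊛-coeff-suc D G n ⟩
  D 0 ℚ.* G (suc n) ℚ.+ (shift D ⊛ G) n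
    ≡⟨ cong₂ ℚ._+_ (trans (cong (ℚ._* G (suc n)) (D≡0 0 z≤n)) (ℚP.*-zeroˡ (G (suc n))))
                   (⊛-coeff-vanishes n (shift D) G (λ m m≤n → D≡0 (suc m) (s≤s m≤n))) ⟩
  0ℚ ℚ.+ 0ℚ
    ≡⟨ ℚP.+-identityʳ 0ℚ ⟩
  0ℚ
    ∎

⊛-cancel-nonZero : ∀ D W → D ⊛ W ≈ κ 0ℚ → .{{_ : ℚ.NonZero (W 0)}} → ∀ n → D n ≡ 0ℚ
⊛-cancel-nonZero D W DW≈0 n = vanish-below n n ℕP.≤-refl
  where
  cancel : ∀ x → x ℚ.* W 0 ≡ 0ℚ → x ≡ 0ℚ
  cancel x xW≡0 = begin
    x                                ≡⟨ ℚP.*-identityʳ x ⟨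
    x ℚ.* 1ℚ                         ≡⟨ cong (x ℚ.*_) (ℚP.*-inverseʳ (W 0)) ⟨
    x ℚ.* (W 0 ℚ.* ℚ.1/ W 0)         ≡⟨ ℚP.*-assoc x (W 0) (ℚ.1/ W 0) ⟨
    x ℚ.* W 0 ℚ.* ℚ.1/ W 0           ≡⟨ cong (ℚ._* ℚ.1/ W 0) xW≡0 ⟩
    0ℚ ℚ.* ℚ.1/ W 0                  ≡⟨ ℚP.*-zeroˡ (ℚ.1/ W 0) ⟩
    0ℚ                               ∎
  vanish-below : ∀ n m → m ≤ n → D m ≡ 0ℚ
  vanish-below n zero _ = cancel (D 0) (trans (sym (⊛-coeff-zero D W)) (DW≈0 0))
  vanish-below (suc n) (suc m) (s≤s m≤n) = cancel (D (suc m)) (begin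
    D (suc m) ℚ.* W 0
      ≡⟨ ℚP.+-identityʳ _ ⟨
    D (suc m) ℚ.* W 0 ℚ.+ 0ℚ
      ≡⟨ cong (D (suc m) ℚ.* W 0 ℚ.+_)
              (⊛-coeff-vanishes m D (shift W) (λ k k≤m → vanish-below n k (ℕP.≤-trans k≤m m≤n))) ⟨
    D (suc m) ℚ.* W 0 ℚ.+ (D ⊛ shift W) m
      ≡⟨ ⊛-coeff-sucʳ D W m ⟨
    (D ⊛ W) (suc m)
      ≡⟨ DW≈0 (suc m) ⟩
    0ℚ
      ∎)

square-root-unique : ∀ S S′ → S ⊛ S ≈ S′ ⊛ S′ → S 0 ≡ 1ℚ → S′ 0 ≡ 1ℚ → S ≈ S′
square-root-unique S S′ S²≈S′² S₀≡1 S′₀≡1 n = begin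
  S n                        ≡⟨ solve 2 (λ S S′ → S := (S :- S′) :+ S′) (λ _ → refl) S S′ n ⟩
  (S ⊖ S′) n ℚ.+ S′ n        ≡⟨ cong (ℚ._+ S′ n) (⊛-cancel-nonZero (S ⊖ S′) (S ⊕ S′) difference-of-squares n) ⟩
  0ℚ ℚ.+ S′ n                ≡⟨ ℚP.+-identityˡ (S′ n) ⟩
  S′ n                       ∎
  where
  difference-of-squares : (S ⊖ S′) ⊛ (S ⊕ S′) ≈ κ 0ℚ
  difference-of-squares = ≈-by-combination ((c 1 , S ⊛ S , S′ ⊛ S′) ∷ [])
    (solve 2 (λ S S′ → (S :- S′) :* (S :+ S′) := # 0 :+ (# 1 :* (S :* S :- S′ :* S′) :+ # 0)) (λ _ → refl) S S′)
    (S²≈S′² ∷ [])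
  instance
    S₀+S′₀≢0 : ℚ.NonZero ((S ⊕ S′) 0)
    S₀+S′₀≢0 = subst ℚ.NonZero (sym (cong₂ ℚ._+_ S₀≡1 S′₀≡1)) _

-- Generating functions of stars

successorSeries : (ℕ → ℕ → PS) → ℕ → ℕ → PS
successorSeries = sumSuccessors _⊕_ (κ 0ℚ)

ℚ[+] : ∀ m n → ℚ[ m ℕ.+ n ] ≡ ℚ[ m ] ℚ.+ ℚ[ n ]
ℚ[+] m n = ιℤ-+ (+ m) (+ n)

sumSuccessors-coeff : ∀ (f : ℕ → ℕ → ℕ) (F : ℕ → ℕ → PS) n i j →
  (∀ s {i′ j′} → starStep i j s ≡ just (i′ , j′) → ℚ[ f i′ j′ ] ≡ F i′ j′ n) →
  ℚ[ sumSuccessors ℕ._+_ 0 f i j ] ≡ successorSeries F i j n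
sumSuccessors-coeff f F n i j f≡F = go allStep3
  where
  f-at : Step3 → ℕ
  f-at s = maybe′ (uncurry f) 0 (starStep i j s)
  F-at : Step3 → PS
  F-at s = maybe′ (uncurry F) (κ 0ℚ) (starStep i j s)
  term : ∀ s → ℚ[ f-at s ] ≡ F-at s n
  term s with starStep i j s in eq
  ... | just (i′ , j′) = f≡F s eq
  ... | nothing        = sym (κ0-coeff n)
  go : ∀ ss → ℚ[ foldr (λ s acc → f-at s ℕ.+ acc) 0 ss ] ≡ foldr (λ s acc → F-at s ⊕ acc) (κ 0ℚ) ss n
  go []       = sym (κ0-coeff n)
  go (s ∷ ss) = trans (ℚ[+] (f-at s) (foldr (λ s acc → f-at s ℕ.+ acc) 0 ss)) (cong₂ ℚ._+_ (term s) (go ss))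

successorSeries-⊛ˡ : ∀ G (F : ℕ → ℕ → PS) i j →
                     successorSeries (λ i′ j′ → G ⊛ F i′ j′) i j ≈ G ⊛ successorSeries F i j
successorSeries-⊛ˡ G F i j = go allStep3
  where
  GF-at F-at : Step3 → PS
  GF-at s = maybe′ (uncurry (λ i′ j′ → G ⊛ F i′ j′)) (κ 0ℚ) (starStep i j s)
  F-at  s = maybe′ (uncurry F) (κ 0ℚ) (starStep i j s)
  term : ∀ s → GF-at s ≈ G ⊛ F-at s
  term s with starStep i j s
  ... | just _  = λ _ → refl
  ... | nothing = solve 1 (λ G → # 0 := G :* # 0) (λ _ → refl) G
  go : ∀ ss → foldr (λ s acc → GF-at s ⊕ acc) (κ 0ℚ) ss ≈ G ⊛ foldr (λ s acc → F-at s ⊕ acc) (κ 0ℚ) ss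
  go []       = solve 1 (λ G → # 0 := G :* # 0) (λ _ → refl) G
  go (s ∷ ss) = ≈-by-combination ((κ 1ℚ , GF-at s , G ⊛ F-at s) ∷ (κ 1ℚ , rest-l , G ⊛ rest-r) ∷ [])
    (solve 5 (λ G A B C D → A :+ C := G :* (B :+ D) :+ (# 1 :* (A :- G :* B) :+ (# 1 :* (C :- G :* D) :+ # 0)))
           (λ _ → refl) G (GF-at s) (F-at s) rest-l rest-r)
    (term s ∷ go ss ∷ [])
    where
    rest-l rest-r : PS
    rest-l = foldr (λ s acc → GF-at s ⊕ acc) (κ 0ℚ) ss
    rest-r = foldr (λ s acc → F-at s ⊕ acc) (κ 0ℚ) ss

numeratorO : PS → PS → PS → PS
numeratorO T X Y = (c 1 ⊕ tt) ⊖ c 3 ⊛ tt ⊛ (Y ⊛ (c 2 ⊕ T) ⊖ X ⊛ Y ⊛ (c 1 ⊕ c 2 ⊛ T) ⊕ X ⊛ (c 2 ⊕ T))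

numeratorV : PS → PS → PS
numeratorV X Y = (c 1 ⊖ X) ⊛ (c 1 ⊖ Y)

denominatorO : PS
denominatorO = (c 1 ⊖ c 8 ⊛ tt) ⊛ (c 1 ⊕ tt)

private
  N̂ : ∀ {m} → Polynomial m → Polynomial m → Polynomial m → Polynomial m → Polynomial m
  N̂ T t X Y = (# 1 :+ t) :- # 3 :* t :* (Y :* (# 2 :+ T) :- X :* Y :* (# 1 :+ # 2 :* T) :+ X :* (# 2 :+ T))

  V̂ : ∀ {m} → Polynomial m → Polynomial m → Polynomial m
  V̂ X Y = (# 1 :- X) :* (# 1 :- Y)

  Ê : ∀ {m} → Polynomial m → Polynomial m → Polynomial m
  Ê T t = # 2 :* t :* ((# 1 :+ T) :* ((# 1 :+ T) :* # 1))

  D̂ : ∀ {m} → Polynomial m → Polynomial m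
  D̂ t = (# 1 :- # 8 :* t) :* (# 1 :+ t)

denominatorO-inverse : (inv[1-8t] ⊛ inv[1+t]) ⊛ denominatorO ≈ c 1
denominatorO-inverse = ≈-by-combination
  ((inv[1+t] ⊛ (c 1 ⊕ tt) , (c 1 ⊖ c 8 ⊛ tt) ⊛ inv[1-8t] , c 1) ∷ (κ 1ℚ , (c 1 ⊕ tt) ⊛ inv[1+t] , c 1) ∷ [])
  (solve 3 (λ A B t → A :* B :* D̂ t
                      := # 1 :+ (B :* (# 1 :+ t) :* ((# 1 :- # 8 :* t) :* A :- # 1) :+ (# 1 :* ((# 1 :+ t) :* B :- # 1) :+ # 0)))
         (λ _ → refl) inv[1-8t] inv[1+t] tt)
  (inv[1-8t]-inverse ∷ inv[1+t]-inverse ∷ [])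

divided-recursion : ∀ {D D⁻¹} (F : ℕ → ℕ → PS) i j → D⁻¹ ⊛ D ≈ c 1 →
  F i j ≈ D ⊕ tt ⊛ successorSeries F i j →
  D⁻¹ ⊛ F i j ≈ κ 1ℚ ⊕ tt ⊛ successorSeries (λ i′ j′ → D⁻¹ ⊛ F i′ j′) i j
divided-recursion {D} {D⁻¹} F i j inverse recursion =
  ≈-by-combination ((D⁻¹ , F i j , D ⊕ tt ⊛ S) ∷ (κ 1ℚ , D⁻¹ ⊛ D , c 1) ∷ (negate tt , S′ , D⁻¹ ⊛ S) ∷ [])
    (solve 6 (λ D D⁻¹ F t S S′ →
      D⁻¹ :* F := # 1 :+ t :* S′
        :+ (D⁻¹ :* (F :- (D :+ t :* S)) :+ (# 1 :* (D⁻¹ :* D :- # 1) :+ ((:- t) :* (S′ :- D⁻¹ :* S) :+ # 0))))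
      (λ _ → refl) D D⁻¹ (F i j) tt S S′)
    (recursion ∷ inverse ∷ successorSeries-⊛ˡ D⁻¹ F i j ∷ [])
  where
  S S′ : PS
  S  = successorSeries F i j
  S′ = successorSeries (λ i′ j′ → D⁻¹ ⊛ F i′ j′) i j

module StarSeries {T : PS} (hT : T ≈ c 2 ⊛ tt ⊛ ((c 1 ⊕ T) ^^ 2)) where

  oscNumerator vicNumerator : ℕ → ℕ → PS
  oscNumerator i j = numeratorO T (T ^^ i) (T ^^ j)
  vicNumerator i j = numeratorV (T ^^ i) (T ^^ j)

  -- Each case is a polynomial identity modulo T = 2t(1 + T)²; the multiplier of
  -- T − 2t(1 + T)² is the exact quotient.
  oscNumerator-recursion : ∀ i j → ¬ (i ≡ 0 × j ≡ 0) →
    oscNumerator i j ≈ denominatorO ⊕ tt ⊛ successorSeries oscNumerator i j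
  oscNumerator-recursion zero zero nz = ⊥-elim (nz (refl , refl))
  oscNumerator-recursion zero (suc l) _ =
    ≈-by-combination ((c 3 ⊛ tt ⊛ (T ⊛ Y ⊖ Y ⊖ c 1) , T , c 2 ⊛ tt ⊛ ((c 1 ⊕ T) ^^ 2)) ∷ [])
      (solve 3 (λ T t Y →
        N̂ T t (# 1) (T :* Y)
        := D̂ t :+ t :* (# 0 :+ (# 0 :+ (# 0 :+ (# 0 :+ (N̂ T t (T :* # 1) (T :* Y)
                       :+ (N̂ T t (T :* # 1) Y :+ (# 0 :+ (# 0 :+ # 0))))))))
           :+ ((# 3 :* t :* (T :* Y :- Y :- # 1)) :* (T :- Ê T t) :+ # 0))
        (λ _ → refl) T tt Y)
      (hT ∷ [])
    where
    Y : PS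
    Y = T ^^ l
  oscNumerator-recursion (suc k) zero _ =
    ≈-by-combination ((c 3 ⊛ tt ⊛ (T ⊛ X ⊖ X ⊖ c 1) , T , c 2 ⊛ tt ⊛ ((c 1 ⊕ T) ^^ 2)) ∷ [])
      (solve 3 (λ T t X →
        N̂ T t (T :* X) (# 1)
        := D̂ t :+ t :* (# 0 :+ (# 0 :+ (N̂ T t X (T :* # 1) :+ (# 0 :+ (# 0 :+ (# 0
                       :+ (N̂ T t (T :* X) (T :* # 1) :+ (# 0 :+ # 0))))))))
           :+ ((# 3 :* t :* (T :* X :- X :- # 1)) :* (T :- Ê T t) :+ # 0))
        (λ _ → refl) T tt X)
      (hT ∷ [])
    where
    X : PS
    X = T ^^ k
  oscNumerator-recursion (suc k) (suc l) _ =
    ≈-by-combination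
      ((c 3 ⊛ tt ⊛ (c 2 ⊛ T ⊛ T ⊛ X ⊛ Y ⊕ T ⊛ X ⊛ Y ⊖ T ⊛ Y ⊖ T ⊛ X ⊖ c 2 ⊛ Y ⊖ c 2 ⊛ X) ,
        T , c 2 ⊛ tt ⊛ ((c 1 ⊕ T) ^^ 2)) ∷ [])
      (solve 4 (λ T t X Y →
        N̂ T t (T :* X) (T :* Y)
        := D̂ t :+ t :* (N̂ T t (T :* X) (T :* Y) :+ (N̂ T t (T :* X) Y :+ (N̂ T t X (T :* (T :* Y))
                       :+ (N̂ T t X (T :* Y) :+ (N̂ T t (T :* (T :* X)) (T :* Y) :+ (N̂ T t (T :* (T :* X)) Y
                       :+ (N̂ T t (T :* X) (T :* (T :* Y)) :+ (N̂ T t (T :* X) (T :* Y) :+ # 0))))))))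
           :+ ((# 3 :* t :* (# 2 :* T :* T :* X :* Y :+ T :* X :* Y :- T :* Y :- T :* X :- # 2 :* Y :- # 2 :* X))
                 :* (T :- Ê T t) :+ # 0))
        (λ _ → refl) T tt X Y)
      (hT ∷ [])
    where
    X Y : PS
    X = T ^^ k
    Y = T ^^ l

  vicNumerator-zeroˡ : ∀ j → vicNumerator 0 j ≈ κ 0ℚ
  vicNumerator-zeroˡ j = solve 1 (λ Y → V̂ (# 1) Y := # 0) (λ _ → refl) (T ^^ j)

  vicNumerator-zeroʳ : ∀ i → vicNumerator i 0 ≈ κ 0ℚ
  vicNumerator-zeroʳ i = solve 1 (λ X → V̂ X (# 1) := # 0) (λ _ → refl) (T ^^ i)

  vicNumerator-recursion : ∀ k l →
    vicNumerator (suc k) (suc l) ≈ (c 1 ⊖ c 8 ⊛ tt) ⊕ tt ⊛ successorSeries vicNumerator (suc k) (suc l)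
  vicNumerator-recursion k l =
    ≈-by-combination ((T ⊛ X ⊛ Y ⊖ Y ⊖ X , T , c 2 ⊛ tt ⊛ ((c 1 ⊕ T) ^^ 2)) ∷ [])
      (solve 4 (λ T t X Y →
        V̂ (T :* X) (T :* Y)
        := (# 1 :- # 8 :* t) :+ t :* (V̂ (T :* X) (T :* Y) :+ (V̂ (T :* X) Y :+ (V̂ X (T :* (T :* Y))
                       :+ (V̂ X (T :* Y) :+ (V̂ (T :* (T :* X)) (T :* Y) :+ (V̂ (T :* (T :* X)) Y
                       :+ (V̂ (T :* X) (T :* (T :* Y)) :+ (V̂ (T :* X) (T :* Y) :+ # 0))))))))
           :+ ((T :* X :* Y :- Y :- X) :* (T :- Ê T t) :+ # 0))
        (λ _ → refl) T tt X Y)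
      (hT ∷ [])
    where
    X Y : PS
    X = T ^^ k
    Y = T ^^ l

  oscSeries vicSeries : ℕ → ℕ → PS
  oscSeries i j = (inv[1-8t] ⊛ inv[1+t]) ⊛ oscNumerator i j
  vicSeries i j = inv[1-8t] ⊛ vicNumerator i j

  oscSeries-recursion : ∀ i j → ¬ (i ≡ 0 × j ≡ 0) → oscSeries i j ≈ κ 1ℚ ⊕ tt ⊛ successorSeries oscSeries i j
  oscSeries-recursion i j nz =
    divided-recursion {denominatorO} {inv[1-8t] ⊛ inv[1+t]} oscNumerator i j denominatorO-inverse (oscNumerator-recursion i j nz)

  vicSeries-recursion : ∀ k l → vicSeries (suc k) (suc l) ≈ κ 1ℚ ⊕ tt ⊛ successorSeries vicSeries (suc k) (suc l)
  vicSeries-recursion k l = divided-recursion {c 1 ⊖ c 8 ⊛ tt} {inv[1-8t]} vicNumerator (suc k) (suc l)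
    inv[1-8t]-inverseˡ (vicNumerator-recursion k l)

  oscSeries-coeff : ∀ n i j → ¬ (i ≡ 0 × j ≡ 0) → ℚ[ oscByGaps n i j ] ≡ oscSeries i j n
  oscSeries-coeff zero    i j nz =
    sym (one-plus-tt-coeff-zero (oscSeries i j) (successorSeries oscSeries i j) (oscSeries-recursion i j nz))
  oscSeries-coeff (suc n) i j nz = begin
    ℚ[ sumSuccessors ℕ._+_ 0 (oscByGaps n) i j ]
      ≡⟨ sumSuccessors-coeff (oscByGaps n) oscSeries n i j
           (λ s {i′} {j′} eq → oscSeries-coeff n i′ j′ (starStep-avoids-origin i j s eq)) ⟩
    successorSeries oscSeries i j n
      ≡⟨ one-plus-tt-coeff-suc (oscSeries i j) (successorSeries oscSeries i j) (oscSeries-recursion i j nz) n ⟨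
    oscSeries i j (suc n)
      ∎

  vicSeries-vanishes : ∀ i j → vicNumerator i j ≈ κ 0ℚ → ∀ n → vicSeries i j n ≡ 0ℚ
  vicSeries-vanishes i j vanishes n = begin
    (inv[1-8t] ⊛ vicNumerator i j) n  ≡⟨ ⊛-cong {inv[1-8t]} (λ _ → refl) vanishes n ⟩
    (inv[1-8t] ⊛ κ 0ℚ) n              ≡⟨ solve 1 (λ A → A :* # 0 := # 0) (λ _ → refl) inv[1-8t] n ⟩
    κ 0ℚ n                            ≡⟨ κ0-coeff n ⟩
    0ℚ                                ∎

  vicSeries-coeff : ∀ n i j → ℚ[ vicByGaps n i j ] ≡ vicSeries i j n
  vicSeries-coeff n zero j          = sym (vicSeries-vanishes 0 j (vicNumerator-zeroˡ j) n)
  vicSeries-coeff n (suc k) zero    = sym (vicSeries-vanishes (suc k) 0 (vicNumerator-zeroʳ (suc k)) n)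
  vicSeries-coeff zero (suc k) (suc l) =
    sym (one-plus-tt-coeff-zero (vicSeries (suc k) (suc l)) (successorSeries vicSeries (suc k) (suc l))
                                (vicSeries-recursion k l))
  vicSeries-coeff (suc n) (suc k) (suc l) = begin
    ℚ[ sumSuccessors ℕ._+_ 0 (vicByGaps n) (suc k) (suc l) ]
      ≡⟨ sumSuccessors-coeff (vicByGaps n) vicSeries n (suc k) (suc l) (λ _ {i′} {j′} _ → vicSeries-coeff n i′ j′) ⟩
    successorSeries vicSeries (suc k) (suc l) n
      ≡⟨ one-plus-tt-coeff-suc (vicSeries (suc k) (suc l)) (successorSeries vicSeries (suc k) (suc l))
                               (vicSeries-recursion k l) n ⟨
    vicSeries (suc k) (suc l) (suc n)
      ∎

  O≈oscSeries : ∀ i j → ¬ (i ≡ 0 × j ≡ 0) → O i j ≈ oscSeries i j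
  O≈oscSeries i j nz n = begin
    ℚ[ oscCount i j n ]  ≡⟨ cong ℚ[_] (trans (countBy-countTrue _ n) (countTrue-osculating n (star-halfGaps i j))) ⟩
    ℚ[ oscByGaps n i j ] ≡⟨ oscSeries-coeff n i j nz ⟩
    oscSeries i j n      ∎

  V≈vicSeries : ∀ i j → V i j ≈ vicSeries i j
  V≈vicSeries i j n = begin
    ℚ[ vicCount i j n ]  ≡⟨ cong ℚ[_] (trans (countBy-countTrue _ n) (countTrue-vicious n (star-halfGaps i j))) ⟩
    ℚ[ vicByGaps n i j ] ≡⟨ vicSeries-coeff n i j ⟩
    vicSeries i j n      ∎

-- The field ℚ(t, S)

infixl 6 _+ₚ_
infixl 7 _*ₚ_ _·ₚ_

_+ₚ_ : Poly → Poly → Poly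
[]       +ₚ q        = q
(a ∷ p)  +ₚ []       = a ∷ p
(a ∷ p)  +ₚ (b ∷ q)  = (a ℚ.+ b) ∷ (p +ₚ q)

_·ₚ_ : ℚ → Poly → Poly
a ·ₚ []      = []
a ·ₚ (b ∷ p) = (a ℚ.* b) ∷ a ·ₚ p

_*ₚ_ : Poly → Poly → Poly
[]      *ₚ q = []
(a ∷ p) *ₚ q = a ·ₚ q +ₚ (0ℚ ∷ p *ₚ q)

poly-+ₚ : ∀ p q → poly (p +ₚ q) ≈ poly p ⊕ poly q
poly-+ₚ []      q       = solve 1 (λ Q → Q := # 0 :+ Q) (λ _ → refl) (poly q)
poly-+ₚ (a ∷ p) []      = solve 1 (λ P → P := P :+ # 0) (λ _ → refl) (poly (a ∷ p))
poly-+ₚ (a ∷ p) (b ∷ q) = ≈-by-combination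
  ((c 1 , κ (a ℚ.+ b) , κ a ⊕ κ b) ∷ (tt , poly (p +ₚ q) , poly p ⊕ poly q) ∷ [])
  (solve 7 (λ Kab Ka Kb t Ppq Pp Pq → Kab :+ t :* Ppq := (Ka :+ t :* Pp) :+ (Kb :+ t :* Pq)
             :+ (# 1 :* (Kab :- (Ka :+ Kb)) :+ (t :* (Ppq :- (Pp :+ Pq)) :+ # 0)))
     (λ _ → refl) (κ (a ℚ.+ b)) (κ a) (κ b) tt (poly (p +ₚ q)) (poly p) (poly q))
  (κ-+ a b ∷ poly-+ₚ p q ∷ [])

poly-·ₚ : ∀ a p → poly (a ·ₚ p) ≈ κ a ⊛ poly p
poly-·ₚ a []      = solve 1 (λ Ka → # 0 := Ka :* # 0) (λ _ → refl) (κ a)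
poly-·ₚ a (b ∷ p) = ≈-by-combination
  ((c 1 , κ (a ℚ.* b) , κ a ⊛ κ b) ∷ (tt , poly (a ·ₚ p) , κ a ⊛ poly p) ∷ [])
  (solve 6 (λ Kab Ka Kb t Pap Pp → Kab :+ t :* Pap := Ka :* (Kb :+ t :* Pp)
             :+ (# 1 :* (Kab :- Ka :* Kb) :+ (t :* (Pap :- Ka :* Pp) :+ # 0)))
     (λ _ → refl) (κ (a ℚ.* b)) (κ a) (κ b) tt (poly (a ·ₚ p)) (poly p))
  (κ-* a b ∷ poly-·ₚ a p ∷ [])

poly-*ₚ : ∀ p q → poly (p *ₚ q) ≈ poly p ⊛ poly q
poly-*ₚ []      q = solve 1 (λ Q → # 0 := # 0 :* Q) (λ _ → refl) (poly q)
poly-*ₚ (a ∷ p) q = ≈-by-combination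
  ((c 1 , poly (a ·ₚ q +ₚ (0ℚ ∷ p *ₚ q)) , poly (a ·ₚ q) ⊕ poly (0ℚ ∷ p *ₚ q))
   ∷ (c 1 , poly (a ·ₚ q) , κ a ⊛ poly q) ∷ (tt , poly (p *ₚ q) , poly p ⊛ poly q) ∷ [])
  (solve 7 (λ L Paq Ppq Ka Q t Pp → L := (Ka :+ t :* Pp) :* Q
             :+ (# 1 :* (L :- (Paq :+ (# 0 :+ t :* Ppq))) :+ (# 1 :* (Paq :- Ka :* Q) :+ (t :* (Ppq :- Pp :* Q) :+ # 0))))
     (λ _ → refl) (poly (a ·ₚ q +ₚ (0ℚ ∷ p *ₚ q))) (poly (a ·ₚ q)) (poly (p *ₚ q)) (κ a) (poly q) tt (poly p))
  (poly-+ₚ (a ·ₚ q) (0ℚ ∷ p *ₚ q) ∷ poly-·ₚ a q ∷ poly-*ₚ p q ∷ [])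

poly-coeff-zero : ∀ a p → poly (a ∷ p) 0 ≡ a
poly-coeff-zero a p = trans (cong (a ℚ.+_) (tt-⊛-coeff-zero (poly p))) (ℚP.+-identityʳ a)

tt^^-⊛-coeff : ∀ k F → (tt ^^ k ⊛ F) k ≡ F 0
tt^^-⊛-coeff zero    F = κ1-⊛ F 0
tt^^-⊛-coeff (suc k) F = trans (⊛-assoc tt (tt ^^ k) F (suc k)) (trans (tt-⊛-coeff-suc (tt ^^ k ⊛ F) k) (tt^^-⊛-coeff k F))

record NonZeroPoly (R : Poly) : Set where
  field
    order    : ℕ
    unit     : Poly
    factored : poly R ≈ tt ^^ order ⊛ poly unit
    positive : ℚ.Positive (poly unit 0)

NonZeroPoly⇒≉0 : ∀ {R} → NonZeroPoly R → ¬ (poly R ≈ κ 0ℚ)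
NonZeroPoly⇒≉0 {R} nz R≈0 = ℚP.<-irrefl refl (ℚP.positive⁻¹ 0ℚ {{subst ℚ.Positive unit₀≡0 positive}})
  where
  open NonZeroPoly nz
  unit₀≡0 : poly unit 0 ≡ 0ℚ
  unit₀≡0 = trans (sym (tt^^-⊛-coeff order (poly unit))) (trans (sym (factored order)) (trans (R≈0 order) (κ0-coeff order)))

positive-constant-NonZeroPoly : ∀ a p → ℚ.Positive a → NonZeroPoly (a ∷ p)
positive-constant-NonZeroPoly a p pos = record
  { order = 0 ; unit = a ∷ p ; factored = λ n → sym (κ1-⊛ (poly (a ∷ p)) n)
  ; positive = subst ℚ.Positive (sym (poly-coeff-zero a p)) pos }

*ₚ-NonZeroPoly : ∀ {R₁ R₂} → NonZeroPoly R₁ → NonZeroPoly R₂ → NonZeroPoly (R₁ *ₚ R₂)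
*ₚ-NonZeroPoly {R₁} {R₂} nz₁ nz₂ = record
  { order    = k₁ ℕ.+ k₂
  ; unit     = U₁ *ₚ U₂
  ; factored = ≈-by-combination
      ((c 1 , poly (R₁ *ₚ R₂) , poly R₁ ⊛ poly R₂) ∷ (poly R₂ , poly R₁ , tt ^^ k₁ ⊛ poly U₁)
       ∷ (tt ^^ k₁ ⊛ poly U₁ , poly R₂ , tt ^^ k₂ ⊛ poly U₂)
       ∷ (negate (poly (U₁ *ₚ U₂)) , tt ^^ (k₁ ℕ.+ k₂) , tt ^^ k₁ ⊛ tt ^^ k₂)
       ∷ (negate (tt ^^ k₁ ⊛ tt ^^ k₂) , poly (U₁ *ₚ U₂) , poly U₁ ⊛ poly U₂) ∷ [])
      (solve 9 (λ R₁₂ R₁ R₂ T₁ T₂ T₁₂ U₁ U₂ U₁₂ → R₁₂ := T₁₂ :* U₁₂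
         :+ (# 1 :* (R₁₂ :- R₁ :* R₂) :+ (R₂ :* (R₁ :- T₁ :* U₁) :+ (T₁ :* U₁ :* (R₂ :- T₂ :* U₂)
         :+ ((:- U₁₂) :* (T₁₂ :- T₁ :* T₂) :+ ((:- (T₁ :* T₂)) :* (U₁₂ :- U₁ :* U₂) :+ # 0))))))
         (λ _ → refl) (poly (R₁ *ₚ R₂)) (poly R₁) (poly R₂) (tt ^^ k₁) (tt ^^ k₂) (tt ^^ (k₁ ℕ.+ k₂))
         (poly U₁) (poly U₂) (poly (U₁ *ₚ U₂)))
      (poly-*ₚ R₁ R₂ ∷ NonZeroPoly.factored nz₁ ∷ NonZeroPoly.factored nz₂ ∷ ^^-+ tt k₁ k₂
       ∷ poly-*ₚ U₁ U₂ ∷ [])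
  ; positive = subst ℚ.Positive (sym (trans (poly-*ₚ U₁ U₂ 0) (⊛-coeff-zero (poly U₁) (poly U₂))))
                 (ℚP.pos*pos⇒pos (poly U₁ 0) {{NonZeroPoly.positive nz₁}} (poly U₂ 0) {{NonZeroPoly.positive nz₂}}) }
  where
  open NonZeroPoly nz₁ renaming (order to k₁; unit to U₁) using ()
  open NonZeroPoly nz₂ renaming (order to k₂; unit to U₂) using ()

[1-8t] : Poly
[1-8t] = 1ℚ ∷ ιℤ (ℤ.- + 8) ∷ []

[1-8t][1+t] : Poly
[1-8t][1+t] = 1ℚ ∷ ιℤ (ℤ.- + 7) ∷ ιℤ (ℤ.- + 8) ∷ []

poly-[1-8t] : poly [1-8t] ≈ c 1 ⊖ c 8 ⊛ tt
poly-[1-8t] = solve 1 (λ t → # 1 :+ t :* (con (ℤ.- + 8) :+ t :* # 0) := # 1 :- # 8 :* t) (λ _ → refl) tt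

poly-[1-8t][1+t]-⊛ : ∀ F → poly [1-8t][1+t] ⊛ F ≈ (c 1 ⊖ c 8 ⊛ tt) ⊛ F ⊛ (c 1 ⊕ tt)
poly-[1-8t][1+t]-⊛ F = solve 2 (λ F t → (# 1 :+ t :* (con (ℤ.- + 7) :+ t :* (con (ℤ.- + 8) :+ t :* # 0))) :* F
                                       := (# 1 :- # 8 :* t) :* F :* (# 1 :+ t))
                               (λ _ → refl) F tt

poly-+ₚ-*ₚ : ∀ a b d e → poly (a *ₚ b +ₚ d *ₚ e) ≈ poly a ⊛ poly b ⊕ poly d ⊛ poly e
poly-+ₚ-*ₚ a b d e = ≈-by-combination
  ((c 1 , poly (a *ₚ b +ₚ d *ₚ e) , poly (a *ₚ b) ⊕ poly (d *ₚ e))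
   ∷ (c 1 , poly (a *ₚ b) , poly a ⊛ poly b) ∷ (c 1 , poly (d *ₚ e) , poly d ⊛ poly e) ∷ [])
  (solve 7 (λ L AB DE A B D E → L := A :* B :+ D :* E
             :+ (# 1 :* (L :- (AB :+ DE)) :+ (# 1 :* (AB :- A :* B) :+ (# 1 :* (DE :- D :* E) :+ # 0))))
     (λ _ → refl) (poly (a *ₚ b +ₚ d *ₚ e)) (poly (a *ₚ b)) (poly (d *ₚ e)) (poly a) (poly b) (poly d) (poly e))
  (poly-+ₚ (a *ₚ b) (d *ₚ e) ∷ poly-*ₚ a b ∷ poly-*ₚ d e ∷ [])

module _ (S : PS) where

  record Fraction (F : PS) : Set where
    field
      P Q R   : Poly
      nonZero : NonZeroPoly R
      cleared : poly R ⊛ F ≈ poly P ⊕ poly Q ⊛ S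

  open Fraction

  one : NonZeroPoly (1ℚ ∷ [])
  one = positive-constant-NonZeroPoly 1ℚ [] _

  fraction-cong : ∀ {F G} → F ≈ G → Fraction F → Fraction G
  fraction-cong {F} {G} F≈G f = record
    { P = P f ; Q = Q f ; R = R f ; nonZero = nonZero f
    ; cleared = λ n → trans (⊛-cong {poly (R f)} {_} {G} {F} (λ _ → refl) (λ m → sym (F≈G m)) n) (cleared f n) }

  fraction-κ : ∀ a → Fraction (κ a)
  fraction-κ a = record
    { P = a ∷ [] ; Q = [] ; R = 1ℚ ∷ [] ; nonZero = one
    ; cleared = solve 3 (λ Ka t S → (# 1 :+ t :* # 0) :* Ka := (Ka :+ t :* # 0) :+ # 0 :* S) (λ _ → refl) (κ a) tt S }

  fraction-tt : Fraction tt
  fraction-tt = record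
    { P = 0ℚ ∷ 1ℚ ∷ [] ; Q = [] ; R = 1ℚ ∷ [] ; nonZero = one
    ; cleared = solve 2 (λ t S → (# 1 :+ t :* # 0) :* t := (# 0 :+ t :* (# 1 :+ t :* # 0)) :+ # 0 :* S) (λ _ → refl) tt S }

  fraction-negate : ∀ {F} → Fraction F → Fraction (negate F)
  fraction-negate {F} f = record
    { P = (ℚ.- 1ℚ) ·ₚ P f ; Q = (ℚ.- 1ℚ) ·ₚ Q f ; R = R f ; nonZero = nonZero f
    ; cleared = ≈-by-combination
        ((negate (c 1) , poly (R f) ⊛ F , poly (P f) ⊕ poly (Q f) ⊛ S)
         ∷ (negate (c 1) , poly ((ℚ.- 1ℚ) ·ₚ P f) , κ (ℚ.- 1ℚ) ⊛ poly (P f))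
         ∷ (negate S , poly ((ℚ.- 1ℚ) ·ₚ Q f) , κ (ℚ.- 1ℚ) ⊛ poly (Q f)) ∷ [])
        (solve 7 (λ R F P Q S P′ Q′ → R :* (:- F) := P′ :+ Q′ :* S
           :+ ((:- # 1) :* (R :* F :- (P :+ Q :* S)) :+ ((:- # 1) :* (P′ :- con (ℤ.- + 1) :* P)
           :+ ((:- S) :* (Q′ :- con (ℤ.- + 1) :* Q) :+ # 0))))
           (λ _ → refl) (poly (R f)) F (poly (P f)) (poly (Q f)) S (poly ((ℚ.- 1ℚ) ·ₚ P f)) (poly ((ℚ.- 1ℚ) ·ₚ Q f)))
        (cleared f ∷ poly-·ₚ (ℚ.- 1ℚ) (P f) ∷ poly-·ₚ (ℚ.- 1ℚ) (Q f) ∷ []) }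

  fraction-⊕ : ∀ {F G} → Fraction F → Fraction G → Fraction (F ⊕ G)
  fraction-⊕ {F} {G} f g = record
    { P = R g *ₚ P f +ₚ R f *ₚ P g ; Q = R g *ₚ Q f +ₚ R f *ₚ Q g ; R = R f *ₚ R g
    ; nonZero = *ₚ-NonZeroPoly (nonZero f) (nonZero g)
    ; cleared = ≈-by-combination
        ((F ⊕ G , poly (R f *ₚ R g) , poly (R f) ⊛ poly (R g))
         ∷ (negate (c 1) , poly (R g *ₚ P f +ₚ R f *ₚ P g) , poly (R g) ⊛ poly (P f) ⊕ poly (R f) ⊛ poly (P g))
         ∷ (negate S , poly (R g *ₚ Q f +ₚ R f *ₚ Q g) , poly (R g) ⊛ poly (Q f) ⊕ poly (R f) ⊛ poly (Q g))
         ∷ (poly (R g) , poly (R f) ⊛ F , poly (P f) ⊕ poly (Q f) ⊛ S)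
         ∷ (poly (R f) , poly (R g) ⊛ G , poly (P g) ⊕ poly (Q g) ⊛ S) ∷ [])
        (solve 12 (λ F G S R₁ R₂ P₁ P₂ Q₁ Q₂ RR PP QQ → RR :* (F :+ G) := PP :+ QQ :* S
           :+ ((F :+ G) :* (RR :- R₁ :* R₂) :+ ((:- # 1) :* (PP :- (R₂ :* P₁ :+ R₁ :* P₂))
           :+ ((:- S) :* (QQ :- (R₂ :* Q₁ :+ R₁ :* Q₂))
           :+ (R₂ :* (R₁ :* F :- (P₁ :+ Q₁ :* S)) :+ (R₁ :* (R₂ :* G :- (P₂ :+ Q₂ :* S)) :+ # 0))))))
           (λ _ → refl) F G S (poly (R f)) (poly (R g)) (poly (P f)) (poly (P g)) (poly (Q f)) (poly (Q g))
           (poly (R f *ₚ R g)) (poly (R g *ₚ P f +ₚ R f *ₚ P g)) (poly (R g *ₚ Q f +ₚ R f *ₚ Q g)))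
        (poly-*ₚ (R f) (R g) ∷ poly-+ₚ-*ₚ (R g) (P f) (R f) (P g) ∷ poly-+ₚ-*ₚ (R g) (Q f) (R f) (Q g)
         ∷ cleared f ∷ cleared g ∷ []) }

  fraction-⊖ : ∀ {F G} → Fraction F → Fraction G → Fraction (F ⊖ G)
  fraction-⊖ f g = fraction-⊕ f (fraction-negate g)

  fraction-⊛ : S ⊛ S ≈ c 1 ⊖ c 8 ⊛ tt → ∀ {F G} → Fraction F → Fraction G → Fraction (F ⊛ G)
  fraction-⊛ S² {F} {G} f g = record
    { P = P f *ₚ P g +ₚ (Q f *ₚ Q g) *ₚ [1-8t] ; Q = P f *ₚ Q g +ₚ Q f *ₚ P g ; R = R f *ₚ R g
    ; nonZero = *ₚ-NonZeroPoly (nonZero f) (nonZero g)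
    ; cleared = ≈-by-combination
        ((F ⊛ G , poly (R f *ₚ R g) , poly (R f) ⊛ poly (R g))
         ∷ (poly (R g) ⊛ G , poly (R f) ⊛ F , poly (P f) ⊕ poly (Q f) ⊛ S)
         ∷ (poly (P f) ⊕ poly (Q f) ⊛ S , poly (R g) ⊛ G , poly (P g) ⊕ poly (Q g) ⊛ S)
         ∷ (poly (Q f) ⊛ poly (Q g) , S ⊛ S , c 1 ⊖ c 8 ⊛ tt)
         ∷ (negate (poly (Q f) ⊛ poly (Q g)) , poly [1-8t] , c 1 ⊖ c 8 ⊛ tt)
         ∷ (negate (c 1) , poly (P f *ₚ P g +ₚ (Q f *ₚ Q g) *ₚ [1-8t]) ,
            poly (P f) ⊛ poly (P g) ⊕ poly (Q f *ₚ Q g) ⊛ poly [1-8t])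
         ∷ (negate (poly [1-8t]) , poly (Q f *ₚ Q g) , poly (Q f) ⊛ poly (Q g))
         ∷ (negate S , poly (P f *ₚ Q g +ₚ Q f *ₚ P g) , poly (P f) ⊛ poly (Q g) ⊕ poly (Q f) ⊛ poly (P g)) ∷ [])
        (solve 15 (λ F G S t R₁ R₂ P₁ P₂ Q₁ Q₂ RR PP QQ Q₁₂ D → RR :* (F :* G) := PP :+ QQ :* S
           :+ ((F :* G) :* (RR :- R₁ :* R₂)
           :+ (R₂ :* G :* (R₁ :* F :- (P₁ :+ Q₁ :* S))
           :+ ((P₁ :+ Q₁ :* S) :* (R₂ :* G :- (P₂ :+ Q₂ :* S))
           :+ (Q₁ :* Q₂ :* (S :* S :- (# 1 :- # 8 :* t))
           :+ ((:- (Q₁ :* Q₂)) :* (D :- (# 1 :- # 8 :* t))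
           :+ ((:- # 1) :* (PP :- (P₁ :* P₂ :+ Q₁₂ :* D))
           :+ ((:- D) :* (Q₁₂ :- Q₁ :* Q₂)
           :+ ((:- S) :* (QQ :- (P₁ :* Q₂ :+ Q₁ :* P₂))
           :+ # 0)))))))))
           (λ _ → refl) F G S tt (poly (R f)) (poly (R g)) (poly (P f)) (poly (P g)) (poly (Q f)) (poly (Q g))
           (poly (R f *ₚ R g)) (poly (P f *ₚ P g +ₚ (Q f *ₚ Q g) *ₚ [1-8t])) (poly (P f *ₚ Q g +ₚ Q f *ₚ P g))
           (poly (Q f *ₚ Q g)) (poly [1-8t]))
        (poly-*ₚ (R f) (R g) ∷ cleared f ∷ cleared g ∷ S² ∷ poly-[1-8t] ∷ poly-+ₚ-*ₚ (P f) (P g) (Q f *ₚ Q g) [1-8t]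
         ∷ poly-*ₚ (Q f) (Q g) ∷ poly-+ₚ-*ₚ (P f) (Q g) (Q f) (P g) ∷ []) }

  fraction-^^ : S ⊛ S ≈ c 1 ⊖ c 8 ⊛ tt → ∀ {F} → Fraction F → ∀ n → Fraction (F ^^ n)
  fraction-^^ S² f zero    = fraction-κ 1ℚ
  fraction-^^ S² f (suc n) = fraction-⊛ S² f (fraction-^^ S² f n)

  fraction-divide : ∀ {F G} D → NonZeroPoly D → poly D ⊛ F ≈ G → Fraction G → Fraction F
  fraction-divide {F} {G} D nzD DF≈G g = record
    { P = P g ; Q = Q g ; R = R g *ₚ D ; nonZero = *ₚ-NonZeroPoly (nonZero g) nzD
    ; cleared = ≈-by-combination
        ((F , poly (R g *ₚ D) , poly (R g) ⊛ poly D) ∷ (poly (R g) , poly D ⊛ F , G)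
         ∷ (c 1 , poly (R g) ⊛ G , poly (P g) ⊕ poly (Q g) ⊛ S) ∷ [])
        (solve 8 (λ F G S RD R D P Q → RD :* F := P :+ Q :* S
           :+ (F :* (RD :- R :* D) :+ (R :* (D :* F :- G) :+ (# 1 :* (R :* G :- (P :+ Q :* S)) :+ # 0))))
           (λ _ → refl) F G S (poly (R g *ₚ D)) (poly (R g)) (poly D) (poly (P g)) (poly (Q g)))
        (poly-*ₚ (R g) D ∷ DF≈G ∷ cleared g ∷ []) }

  -- T = (1 − 4t − S) / (4t)
  fraction-T : ∀ {T} → S ≈ c 1 ⊖ c 4 ⊛ tt ⊖ c 4 ⊛ tt ⊛ T → Fraction T
  fraction-T {T} S≈ = record
    { P = 1ℚ ∷ ιℤ (ℤ.- + 4) ∷ [] ; Q = ℚ.- 1ℚ ∷ [] ; R = 0ℚ ∷ ℚ[ 4 ] ∷ []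
    ; nonZero = record
        { order = 1 ; unit = ℚ[ 4 ] ∷ []
        ; factored = solve 1 (λ t → # 0 :+ t :* (# 4 :+ t :* # 0) := (t :* # 1) :* (# 4 :+ t :* # 0)) (λ _ → refl) tt
        ; positive = subst ℚ.Positive (sym (poly-coeff-zero ℚ[ 4 ] [])) _ }
    ; cleared = ≈-by-combination ((c 1 , S , c 1 ⊖ c 4 ⊛ tt ⊖ c 4 ⊛ tt ⊛ T) ∷ [])
        (solve 3 (λ T S t → (# 0 :+ t :* (# 4 :+ t :* # 0)) :* T
                     := (# 1 :+ t :* (con (ℤ.- + 4) :+ t :* # 0)) :+ (con (ℤ.- + 1) :+ t :* # 0) :* S
                        :+ (# 1 :* (S :- (# 1 :- # 4 :* t :- # 4 :* t :* T)) :+ # 0))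
           (λ _ → refl) T S tt)
        (S≈ ∷ []) }

  fraction⇒InQtS : ∀ {F} → Fraction F → InQtS S F
  fraction⇒InQtS f = P f , Q f , R f , NonZeroPoly⇒≉0 (nonZero f) , cleared f

  -- (P + Q S) / R is a root of R² X² − 2 R P X + P² − Q² (1 − 8t).
  fraction⇒Algebraic : S ⊛ S ≈ c 1 ⊖ c 8 ⊛ tt → ∀ {F} → Fraction F → Algebraic F
  fraction⇒Algebraic S² {F} f =
    A₀ ∷ A₁ ∷ A₂ ∷ [] , there (there (here (NonZeroPoly⇒≉0 (*ₚ-NonZeroPoly (nonZero f) (nonZero f))))) , root
    where
    A₀ A₁ A₂ : Poly
    A₀ = P f *ₚ P f +ₚ (Q f *ₚ Q f) *ₚ (ℚ.- 1ℚ ·ₚ [1-8t])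
    A₁ = ιℤ (ℤ.- + 2) ·ₚ (R f *ₚ P f)
    A₂ = R f *ₚ R f
    root : evalAt (A₀ ∷ A₁ ∷ A₂ ∷ []) F ≈ κ 0ℚ
    root = ≈-by-combination
      ((c 1 , poly A₀ , poly (P f) ⊛ poly (P f) ⊕ poly (Q f *ₚ Q f) ⊛ poly (ℚ.- 1ℚ ·ₚ [1-8t]))
       ∷ (poly (ℚ.- 1ℚ ·ₚ [1-8t]) , poly (Q f *ₚ Q f) , poly (Q f) ⊛ poly (Q f))
       ∷ (poly (Q f) ⊛ poly (Q f) , poly (ℚ.- 1ℚ ·ₚ [1-8t]) , κ (ℚ.- 1ℚ) ⊛ poly [1-8t])
       ∷ (negate (poly (Q f) ⊛ poly (Q f)) , poly [1-8t] , c 1 ⊖ c 8 ⊛ tt)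
       ∷ (F , poly A₁ , κ (ιℤ (ℤ.- + 2)) ⊛ poly (R f *ₚ P f))
       ∷ (F ⊛ κ (ιℤ (ℤ.- + 2)) , poly (R f *ₚ P f) , poly (R f) ⊛ poly (P f))
       ∷ (F ⊛ F , poly A₂ , poly (R f) ⊛ poly (R f))
       ∷ (poly (R f) ⊛ F ⊖ poly (P f) ⊕ poly (Q f) ⊛ S , poly (R f) ⊛ F , poly (P f) ⊕ poly (Q f) ⊛ S)
       ∷ (poly (Q f) ⊛ poly (Q f) , S ⊛ S , c 1 ⊖ c 8 ⊛ tt) ∷ [])
      (solve 14 (λ F S t R P Q A₀ A₁ A₂ RP QQ -D D RR →
        A₀ :+ F :* (A₁ :+ F :* (A₂ :+ F :* # 0)) := # 0
        :+ (# 1 :* (A₀ :- (P :* P :+ QQ :* -D))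
        :+ (-D :* (QQ :- Q :* Q)
        :+ (Q :* Q :* (-D :- con (ℤ.- + 1) :* D)
        :+ ((:- (Q :* Q)) :* (D :- (# 1 :- # 8 :* t))
        :+ (F :* (A₁ :- con (ℤ.- + 2) :* RP)
        :+ (F :* con (ℤ.- + 2) :* (RP :- R :* P)
        :+ (F :* F :* (A₂ :- R :* R)
        :+ ((R :* F :- P :+ Q :* S) :* (R :* F :- (P :+ Q :* S))
        :+ (Q :* Q :* (S :* S :- (# 1 :- # 8 :* t))
        :+ # 0))))))))))
        (λ _ → refl) F S tt (poly (R f)) (poly (P f)) (poly (Q f)) (poly A₀) (poly A₁) (poly A₂)
        (poly (R f *ₚ P f)) (poly (Q f *ₚ Q f)) (poly (ℚ.- 1ℚ ·ₚ [1-8t])) (poly [1-8t]) (poly (R f *ₚ R f)))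
      (poly-+ₚ-*ₚ (P f) (P f) (Q f *ₚ Q f) (ℚ.- 1ℚ ·ₚ [1-8t]) ∷ poly-*ₚ (Q f) (Q f) ∷ poly-·ₚ (ℚ.- 1ℚ) [1-8t]
       ∷ poly-[1-8t]
       ∷ poly-·ₚ (ιℤ (ℤ.- + 2)) (R f *ₚ P f) ∷ poly-*ₚ (R f) (P f) ∷ poly-*ₚ (R f) (R f) ∷ cleared f ∷ S² ∷ [])

-- The closed forms

clear-denominator : ∀ {D D⁻¹ F N} → D⁻¹ ⊛ D ≈ c 1 → F ≈ D⁻¹ ⊛ N → D ⊛ F ≈ N
clear-denominator {D} {D⁻¹} {F} {N} inverse F≈ = ≈-by-combination
  ((D , F , D⁻¹ ⊛ N) ∷ (N , D⁻¹ ⊛ D , c 1) ∷ [])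
  (solve 4 (λ D D⁻¹ F N → D :* F := N :+ (D :* (F :- D⁻¹ :* N) :+ (N :* (D⁻¹ :* D :- # 1) :+ # 0)))
     (λ _ → refl) D D⁻¹ F N)
  (F≈ ∷ inverse ∷ [])

numerator⇒second-form : ∀ {T F X Y Z} → denominatorO ⊛ F ≈ numeratorO T X Y → Z ≈ X ⊛ Y →
  (c 1 ⊖ c 8 ⊛ tt) ⊛ F ⊛ (c 1 ⊕ tt)
    ≈ (c 1 ⊕ tt) ⊖ c 3 ⊛ tt ⊛ (Y ⊛ (c 2 ⊕ T) ⊖ Z ⊛ (c 1 ⊕ c 2 ⊛ T) ⊕ X ⊛ (c 2 ⊕ T))
numerator⇒second-form {T} {F} {X} {Y} {Z} DF≈N Z≈XY = ≈-by-combination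
  ((c 1 , denominatorO ⊛ F , numeratorO T X Y) ∷ (negate (c 3 ⊛ tt ⊛ (c 1 ⊕ c 2 ⊛ T)) , Z , X ⊛ Y) ∷ [])
  (solve 6 (λ T t F X Y Z →
     (# 1 :- # 8 :* t) :* F :* (# 1 :+ t)
     := (# 1 :+ t) :- # 3 :* t :* (Y :* (# 2 :+ T) :- Z :* (# 1 :+ # 2 :* T) :+ X :* (# 2 :+ T))
        :+ (# 1 :* ((# 1 :- # 8 :* t) :* (# 1 :+ t) :* F
                    :- ((# 1 :+ t) :- # 3 :* t :* (Y :* (# 2 :+ T) :- X :* Y :* (# 1 :+ # 2 :* T) :+ X :* (# 2 :+ T))))
        :+ ((:- (# 3 :* t :* (# 1 :+ # 2 :* T))) :* (Z :- X :* Y) :+ # 0)))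
     (λ _ → refl) T tt F X Y Z)
  (DF≈N ∷ Z≈XY ∷ [])

module _ {T : PS} (hT : T ≈ c 2 ⊛ tt ⊛ ((c 1 ⊕ T) ^^ 2)) where

  t-relation : tt ⊛ ((c 1 ⊕ c 2 ⊛ T) ⊛ (c 2 ⊕ T)) ≈ T ⊛ (c 1 ⊕ tt)
  t-relation = ≈-by-combination ((negate (c 1) , T , c 2 ⊛ tt ⊛ ((c 1 ⊕ T) ^^ 2)) ∷ [])
    (solve 2 (λ T t → t :* ((# 1 :+ # 2 :* T) :* (# 2 :+ T)) := T :* (# 1 :+ t) :+ ((:- # 1) :* (T :- Ê T t) :+ # 0))
       (λ _ → refl) T tt)
    (hT ∷ [])

  second-form⇒first-form : ∀ {F X Y Z Xᵀ Yᵀ Zᵀ} →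
    (c 1 ⊖ c 8 ⊛ tt) ⊛ F ⊛ (c 1 ⊕ tt)
      ≈ (c 1 ⊕ tt) ⊖ c 3 ⊛ tt ⊛ (Y ⊛ (c 2 ⊕ T) ⊖ Z ⊛ (c 1 ⊕ c 2 ⊛ T) ⊕ X ⊛ (c 2 ⊕ T)) →
    Xᵀ ≈ X ⊛ T ^^ 1 → Yᵀ ≈ Y ⊛ T ^^ 1 → Zᵀ ≈ Z ⊛ T ^^ 1 →
    (c 1 ⊖ c 8 ⊛ tt) ⊛ F ⊛ (c 1 ⊕ c 2 ⊛ T) ⊛ (c 2 ⊕ T)
      ≈ (c 1 ⊕ c 2 ⊛ T) ⊛ (c 2 ⊕ T) ⊖ c 3 ⊛ Yᵀ ⊛ (c 2 ⊕ T)
        ⊕ c 3 ⊛ Zᵀ ⊛ (c 1 ⊕ c 2 ⊛ T) ⊖ c 3 ⊛ Xᵀ ⊛ (c 2 ⊕ T)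
  second-form⇒first-form {F} {X} {Y} {Z} {Xᵀ} {Yᵀ} {Zᵀ} second Xᵀ≈ Yᵀ≈ Zᵀ≈ = cancel-invertible {c 1 ⊕ tt} {inv[1+t]} inv[1+t]-inverseˡ
    (≈-by-combination
      ((Q , (c 1 ⊖ c 8 ⊛ tt) ⊛ F ⊛ (c 1 ⊕ tt) , (c 1 ⊕ tt) ⊖ c 3 ⊛ tt ⊛ W)
       ∷ (negate (c 3 ⊛ W) , tt ⊛ Q , T ⊛ (c 1 ⊕ tt))
       ∷ (c 3 ⊛ (c 1 ⊕ tt) ⊛ (c 2 ⊕ T) , Yᵀ , Y ⊛ T ^^ 1)
       ∷ (negate (c 3 ⊛ (c 1 ⊕ tt) ⊛ (c 1 ⊕ c 2 ⊛ T)) , Zᵀ , Z ⊛ T ^^ 1)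
       ∷ (c 3 ⊛ (c 1 ⊕ tt) ⊛ (c 2 ⊕ T) , Xᵀ , X ⊛ T ^^ 1) ∷ [])
      (solve 9 (λ T t F X Y Z Xᵀ Yᵀ Zᵀ →
         (# 1 :+ t) :* ((# 1 :- # 8 :* t) :* F :* (# 1 :+ # 2 :* T) :* (# 2 :+ T))
         := (# 1 :+ t) :* ((# 1 :+ # 2 :* T) :* (# 2 :+ T) :- # 3 :* Yᵀ :* (# 2 :+ T) :+ # 3 :* Zᵀ :* (# 1 :+ # 2 :* T)
                           :- # 3 :* Xᵀ :* (# 2 :+ T))
            :+ ((# 1 :+ # 2 :* T) :* (# 2 :+ T)
                   :* ((# 1 :- # 8 :* t) :* F :* (# 1 :+ t) :- ((# 1 :+ t) :- # 3 :* t :* Ŵ T X Y Z))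
            :+ ((:- (# 3 :* Ŵ T X Y Z)) :* (t :* ((# 1 :+ # 2 :* T) :* (# 2 :+ T)) :- T :* (# 1 :+ t))
            :+ (# 3 :* (# 1 :+ t) :* (# 2 :+ T) :* (Yᵀ :- Y :* (T :* # 1))
            :+ ((:- (# 3 :* (# 1 :+ t) :* (# 1 :+ # 2 :* T))) :* (Zᵀ :- Z :* (T :* # 1))
            :+ (# 3 :* (# 1 :+ t) :* (# 2 :+ T) :* (Xᵀ :- X :* (T :* # 1)) :+ # 0))))))
         (λ _ → refl) T tt F X Y Z Xᵀ Yᵀ Zᵀ)
      (second ∷ t-relation ∷ Yᵀ≈ ∷ Zᵀ≈ ∷ Xᵀ≈ ∷ []))
    where
    Q W : PS
    Q = (c 1 ⊕ c 2 ⊛ T) ⊛ (c 2 ⊕ T)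
    W = Y ⊛ (c 2 ⊕ T) ⊖ Z ⊛ (c 1 ⊕ c 2 ⊛ T) ⊕ X ⊛ (c 2 ⊕ T)
    Ŵ : ∀ {m} → Polynomial m → Polynomial m → Polynomial m → Polynomial m → Polynomial m
    Ŵ T X Y Z = Y :* (# 2 :+ T) :- Z :* (# 1 :+ # 2 :* T) :+ X :* (# 2 :+ T)

  square-root-of-1-8t : ∀ {S} → S ⊛ S ≈ c 1 ⊖ c 8 ⊛ tt → S 0 ≡ 1ℚ → S ≈ c 1 ⊖ c 4 ⊛ tt ⊖ c 4 ⊛ tt ⊛ T
  square-root-of-1-8t {S} S² S₀≡1 =
    square-root-unique S S′ (λ n → trans (S² n) (sym (S′² n))) S₀≡1
      (one-plus-tt-coeff-zero S′ (negate (c 4 ⊕ c 4 ⊛ T))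
        (solve 2 (λ T t → # 1 :- # 4 :* t :- # 4 :* t :* T := # 1 :+ t :* (:- (# 4 :+ # 4 :* T))) (λ _ → refl) T tt))
    where
    S′ : PS
    S′ = c 1 ⊖ c 4 ⊛ tt ⊖ c 4 ⊛ tt ⊛ T
    S′² : S′ ⊛ S′ ≈ c 1 ⊖ c 8 ⊛ tt
    S′² = ≈-by-combination ((negate (c 8 ⊛ tt) , T , c 2 ⊛ tt ⊛ ((c 1 ⊕ T) ^^ 2)) ∷ [])
      (solve 2 (λ T t → (# 1 :- # 4 :* t :- # 4 :* t :* T) :* (# 1 :- # 4 :* t :- # 4 :* t :* T)
                        := (# 1 :- # 8 :* t) :+ ((:- (# 8 :* t)) :* (T :- Ê T t) :+ # 0)) (λ _ → refl) T tt)
      (hT ∷ [])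

module Stars {T S : PS} (hT : T ≈ c 2 ⊛ tt ⊛ ((c 1 ⊕ T) ^^ 2))
             (S² : S ⊛ S ≈ c 1 ⊖ c 8 ⊛ tt) (S₀≡1 : S 0 ≡ 1ℚ) where

  open StarSeries hT

  S≈ : S ≈ c 1 ⊖ c 4 ⊛ tt ⊖ c 4 ⊛ tt ⊛ T
  S≈ = square-root-of-1-8t hT S² S₀≡1

  O-second-form : ∀ i j → ¬ (i ≡ 0 × j ≡ 0) →
    (c 1 ⊖ c 8 ⊛ tt) ⊛ O i j ⊛ (c 1 ⊕ tt)
      ≈ (c 1 ⊕ tt) ⊖ c 3 ⊛ tt ⊛ (T ^^ j ⊛ (c 2 ⊕ T) ⊖ T ^^ (i + j) ⊛ (c 1 ⊕ c 2 ⊛ T) ⊕ T ^^ i ⊛ (c 2 ⊕ T))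
  O-second-form i j nz = numerator⇒second-form {T} {O i j} {T ^^ i} {T ^^ j}
    (clear-denominator {denominatorO} {inv[1-8t] ⊛ inv[1+t]} denominatorO-inverse (O≈oscSeries i j nz))
    (^^-+ T i j)

  O-first-form : ∀ i j → ¬ (i ≡ 0 × j ≡ 0) →
    (c 1 ⊖ c 8 ⊛ tt) ⊛ O i j ⊛ (c 1 ⊕ c 2 ⊛ T) ⊛ (c 2 ⊕ T)
      ≈ (c 1 ⊕ c 2 ⊛ T) ⊛ (c 2 ⊕ T) ⊖ c 3 ⊛ T ^^ (j + 1) ⊛ (c 2 ⊕ T)
        ⊕ c 3 ⊛ T ^^ (i + j + 1) ⊛ (c 1 ⊕ c 2 ⊛ T) ⊖ c 3 ⊛ T ^^ (i + 1) ⊛ (c 2 ⊕ T)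
  O-first-form i j nz = second-form⇒first-form hT {O i j} {T ^^ i} {T ^^ j} {T ^^ (i + j)}
    (O-second-form i j nz) (^^-+ T i 1) (^^-+ T j 1) (^^-+ T (i + j) 1)

  V-closed-form : ∀ i j → (c 1 ⊖ c 8 ⊛ tt) ⊛ V i j ≈ (c 1 ⊖ T ^^ i) ⊛ (c 1 ⊖ T ^^ j)
  V-closed-form i j = clear-denominator {c 1 ⊖ c 8 ⊛ tt} {inv[1-8t]} inv[1-8t]-inverseˡ (V≈vicSeries i j)

  -- Multiplied by 1 − 8t, this is the second form at i = j = 1 modulo T = 2t(1 + T)² and
  -- S = 1 − 4t − 4tT.
  O₁₁-closed-form : c 8 ⊛ tt ^^ 2 ⊛ (c 1 ⊕ tt) ⊛ O 1 1
                    ≈ c 3 ⊖ c 15 ⊛ tt ⊖ c 4 ⊛ tt ^^ 2 ⊖ c 3 ⊛ (c 1 ⊖ tt) ⊛ S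
  O₁₁-closed-form = cancel-invertible {c 1 ⊖ c 8 ⊛ tt} {inv[1-8t]} inv[1-8t]-inverseˡ
    (≈-by-combination
      ((c 8 ⊛ tt ^^ 2 , (c 1 ⊖ c 8 ⊛ tt) ⊛ O₁₁ ⊛ (c 1 ⊕ tt) , second-form-rhs)
       ∷ (c 60 ⊛ tt ^^ 2 ⊖ c 12 ⊛ tt ⊖ c 24 ⊛ tt ^^ 2 ⊛ T , T , c 2 ⊛ tt ⊛ ((c 1 ⊕ T) ^^ 2))
       ∷ ((c 1 ⊖ c 8 ⊛ tt) ⊛ c 3 ⊛ (c 1 ⊖ tt) , S , c 1 ⊖ c 4 ⊛ tt ⊖ c 4 ⊛ tt ⊛ T) ∷ [])
      (solve 4 (λ T t F S →
         (# 1 :- # 8 :* t) :* (# 8 :* t² t :* (# 1 :+ t) :* F)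
         := (# 1 :- # 8 :* t) :* (# 3 :- # 15 :* t :- # 4 :* t² t :- # 3 :* (# 1 :- t) :* S)
            :+ (# 8 :* t² t :* ((# 1 :- # 8 :* t) :* F :* (# 1 :+ t)
                 :- ((# 1 :+ t) :- # 3 :* t :* ((T :* # 1) :* (# 2 :+ T) :- (T :* (T :* # 1)) :* (# 1 :+ # 2 :* T)
                                                 :+ (T :* # 1) :* (# 2 :+ T))))
            :+ ((# 60 :* t² t :- # 12 :* t :- # 24 :* t² t :* T) :* (T :- Ê T t)
            :+ ((# 1 :- # 8 :* t) :* # 3 :* (# 1 :- t) :* (S :- (# 1 :- # 4 :* t :- # 4 :* t :* T)) :+ # 0))))
         (λ _ → refl) T tt O₁₁ S)
      (O-second-form 1 1 (λ { (() , _) }) ∷ hT ∷ S≈ ∷ []))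
    where
    O₁₁ second-form-rhs : PS
    O₁₁ = O 1 1
    second-form-rhs = (c 1 ⊕ tt) ⊖ c 3 ⊛ tt ⊛ (T ^^ 1 ⊛ (c 2 ⊕ T) ⊖ T ^^ 2 ⊛ (c 1 ⊕ c 2 ⊛ T) ⊕ T ^^ 1 ⊛ (c 2 ⊕ T))
    t² : ∀ {m} → Polynomial m → Polynomial m
    t² t = t :* (t :* # 1)

  private
    infixl 6 _⊕ᶠ_ _⊖ᶠ_
    infixl 7 _⊛ᶠ_
    _⊕ᶠ_ : ∀ {F G} → Fraction S F → Fraction S G → Fraction S (F ⊕ G)
    _⊕ᶠ_ = fraction-⊕ S
    _⊖ᶠ_ : ∀ {F G} → Fraction S F → Fraction S G → Fraction S (F ⊖ G)
    _⊖ᶠ_ = fraction-⊖ S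
    _⊛ᶠ_ : ∀ {F G} → Fraction S F → Fraction S G → Fraction S (F ⊛ G)
    _⊛ᶠ_ = fraction-⊛ S S²
    cᶠ : ∀ n → Fraction S (c n)
    cᶠ n = fraction-κ S ℚ[ n ]
    tᶠ : Fraction S tt
    tᶠ = fraction-tt S
    Tᶠ : Fraction S T
    Tᶠ = fraction-T S S≈
    Tᶠ^^ : ∀ n → Fraction S (T ^^ n)
    Tᶠ^^ = fraction-^^ S S² Tᶠ

  O-fraction : ∀ i j → ¬ (i ≡ 0 × j ≡ 0) → Fraction S (O i j)
  O-fraction i j nz = fraction-divide S [1-8t][1+t] (positive-constant-NonZeroPoly 1ℚ _ _)
    (λ n → trans (poly-[1-8t][1+t]-⊛ (O i j) n) (O-second-form i j nz n))
    (cᶠ 1 ⊕ᶠ tᶠ ⊖ᶠ cᶠ 3 ⊛ᶠ tᶠ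
      ⊛ᶠ (Tᶠ^^ j ⊛ᶠ (cᶠ 2 ⊕ᶠ Tᶠ) ⊖ᶠ Tᶠ^^ (i + j) ⊛ᶠ (cᶠ 1 ⊕ᶠ cᶠ 2 ⊛ᶠ Tᶠ) ⊕ᶠ Tᶠ^^ i ⊛ᶠ (cᶠ 2 ⊕ᶠ Tᶠ)))

  V-fraction : ∀ i j → Fraction S (V i j)
  V-fraction i j = fraction-divide S [1-8t] (positive-constant-NonZeroPoly 1ℚ _ _)
    (λ n → trans (⊛-cong {G = V i j} poly-[1-8t] (λ _ → refl) n) (V-closed-form i j n))
    ((cᶠ 1 ⊖ᶠ Tᶠ^^ i) ⊛ᶠ (cᶠ 1 ⊖ᶠ Tᶠ^^ j))

proposition1 : (T S : PS)
    → T ≈ c 2 ⊛ tt ⊛ ((c 1 ⊕ T) ^^ 2)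
    → S ⊛ S ≈ c 1 ⊖ c 8 ⊛ tt
    → S 0 ≡ 1ℚ
    → (∀ (i j : ℕ) → ¬ (i ≡ 0 × j ≡ 0)
        → Algebraic (O i j)
        × InQtS S (O i j)
        × ((c 1 ⊖ c 8 ⊛ tt) ⊛ O i j ⊛ (c 1 ⊕ c 2 ⊛ T) ⊛ (c 2 ⊕ T)
            ≈ (c 1 ⊕ c 2 ⊛ T) ⊛ (c 2 ⊕ T)
              ⊖ c 3 ⊛ T ^^ (j + 1) ⊛ (c 2 ⊕ T)
              ⊕ c 3 ⊛ T ^^ (i + j + 1) ⊛ (c 1 ⊕ c 2 ⊛ T)
              ⊖ c 3 ⊛ T ^^ (i + 1) ⊛ (c 2 ⊕ T))
        × ((c 1 ⊖ c 8 ⊛ tt) ⊛ O i j ⊛ (c 1 ⊕ tt)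
            ≈ (c 1 ⊕ tt)
              ⊖ c 3 ⊛ tt ⊛ (T ^^ j ⊛ (c 2 ⊕ T) ⊖ T ^^ (i + j) ⊛ (c 1 ⊕ c 2 ⊛ T) ⊕ T ^^ i ⊛ (c 2 ⊕ T))))
    × (c 8 ⊛ tt ^^ 2 ⊛ (c 1 ⊕ tt) ⊛ O 1 1
        ≈ c 3 ⊖ c 15 ⊛ tt ⊖ c 4 ⊛ tt ^^ 2 ⊖ c 3 ⊛ (c 1 ⊖ tt) ⊛ S)
    × (∀ (i j : ℕ)
        → Algebraic (V i j)
        × InQtS S (V i j)
        × ((c 1 ⊖ c 8 ⊛ tt) ⊛ V i j ≈ (c 1 ⊖ T ^^ i) ⊛ (c 1 ⊖ T ^^ j)))
proposition1 T S hT S² S₀≡1 =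
  (λ i j nz → fraction⇒Algebraic S S² (O-fraction i j nz) , fraction⇒InQtS S (O-fraction i j nz) ,
              O-first-form i j nz , O-second-form i j nz) ,
  O₁₁-closed-form ,
  (λ i j → fraction⇒Algebraic S S² (V-fraction i j) , fraction⇒InQtS S (V-fraction i j) , V-closed-form i j)
  where open Stars {T} {S} hT S² S₀≡1
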